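{- For every integer $j\ge 1$ and all $x$, \[ T_{j}(x)=j\sum_{m=0}^{\left\lfloor j/2\right\rfloor}(-1)^m\binom{j-m}{j-2m}\frac{2^{j-2m-1}}{j-m}\;{}_{2}F_{1}\!\left(\begin{matrix}-m,\ j-m\\ j-2m+2\end{matrix}\,\Big|\,-4\right)F_{j-2m+1}(x). \]
   Context: The Fibonacci polynomials are defined by $F_0(x)=0$, $F_1(x)=1$, $F_{n+2}(x)=xF_{n+1}(x)+F_n(x)$ for $n\ge 0$. $T_n(x)$ denotes the Chebyshev polynomial of the first kind, $T_n(\cos\theta)=\cos(n\theta)$ (equivalently $T_0=1$, $T_1=x$, $T_n=2xT_{n-1}-T_{n-2}$). For a nonnegative integer $m$, the terminating hypergeometric series is ${}_2F_1\!\left(\begin{smallmatrix}-m,\ b\\ c\end{smallmatrix}\big|z\right)=\sum_{k=0}^{m}\frac{(-m)_k(b)_k}{(c)_k\,k!}z^k$, where $(a)_k=a(a+1)\cdots(a+k-1)$ is the Pochhammer symbol.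
   Formalization: The variable x ranges over the rationals, so the Chebyshev and Fibonacci polynomials are evaluated at rational points. -}

module Defs where

open import Data.Nat as ℕ using (ℕ; zero; suc; ⌊_/2⌋; _!)
open import Data.Integer as ℤ using (ℤ; +_; -[1+_])
open import Data.Rational as ℚ using (ℚ; mkℚ; 0ℚ; 1ℚ; _+_; _*_; _-_; -_; _÷_)
open import Data.Nat.Combinatorics using (_C_)

ℕ→ℚ : ℕ → ℚ
ℕ→ℚ n = + n ℚ./ 1

ℤ→ℚ : ℤ → ℚ
ℤ→ℚ z = z ℚ./ 1

_^ℚ_ : ℚ → ℕ → ℚ
p ^ℚ zero = 1ℚ
p ^ℚ suc n = p * (p ^ℚ n)

-- total division on ℚ (p / 0 := 0); only ever used with nonzero divisors below
_÷₀_ : ℚ → ℚ → ℚ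
p ÷₀ mkℚ (+ zero) _ _ = 0ℚ
p ÷₀ q@(mkℚ (+ suc _) _ _) = p ÷ q
p ÷₀ q@(mkℚ -[1+ _ ] _ _) = p ÷ q

sumTo : ℕ → (ℕ → ℚ) → ℚ
sumTo zero f = f 0
sumTo (suc n) f = sumTo n f + f (suc n)

fibPoly : ℕ → ℚ → ℚ
fibPoly zero x = 0ℚ
fibPoly (suc zero) x = 1ℚ
fibPoly (suc (suc n)) x = x * fibPoly (suc n) x + fibPoly n x

cheb : ℕ → ℚ → ℚ
cheb zero x = 1ℚ
cheb (suc zero) x = x
cheb (suc (suc n)) x = (ℕ→ℚ 2 * x) * cheb (suc n) x - cheb n x

poch : ℚ → ℕ → ℚ
poch a zero = 1ℚ
poch a (suc k) = poch a k * (a + ℕ→ℚ k)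

hyp2F1 : ℕ → ℚ → ℚ → ℚ → ℚ
hyp2F1 m b c z =
  sumTo m (λ k → ((poch (- ℕ→ℚ m) k * poch b k) ÷₀ (poch c k * ℕ→ℚ (k !))) * (z ^ℚ k))

-- the m-th summand of the right-hand side (without the leading factor j):
-- (-1)^m C(j-m, j-2m) 2^(j-2m-1)/(j-m) 2F1(-m, j-m; j-2m+2 | -4) F_{j-2m+1}(x),
-- where 2^(j-2m-1) is written as 2^(j-2m)/2 (the exponent is -1 when j = 2m).
summand : ℕ → ℚ → ℕ → ℚ
summand j x m =
  ((- 1ℚ) ^ℚ m)
  * ℕ→ℚ ((j ℕ.∸ m) C (j ℕ.∸ (2 ℕ.* m)))
  * (((ℕ→ℚ 2 ^ℚ (j ℕ.∸ (2 ℕ.* m))) ÷₀ ℕ→ℚ 2) ÷₀ ℕ→ℚ (j ℕ.∸ m))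
  * hyp2F1 m (ℕ→ℚ (j ℕ.∸ m)) (ℕ→ℚ ((j ℕ.∸ (2 ℕ.* m)) ℕ.+ 2)) (- ℕ→ℚ 4)
  * fibPoly ((j ℕ.∸ (2 ℕ.* m)) ℕ.+ 1) x

-- Write j = p + 2h with p ∈ {0, 1}. The recursion T_{n+2} = 2x T_{n+1} - T_n expands T_j in the
-- powers x^{p+2s}, and x F_{n+1} = F_{n+2} - F_n expands each x^{p+2s} in the F_{p+2r+1}, so T_j is
-- a double sum over r ≤ s ≤ h. Both families of coefficients satisfy Pascal-type recursions,
-- which identify them with the closed forms
--   (-1)^i 2^N (N+2i) (N+i)! / (i! N! 2(N+i))   and   (-1)^k (n+1) (n+2k)! / (k! (n+k+1)!).
-- Summing by columns, the coefficient of F_{n+1} with n = j - 2m is a sum over k ≤ m of products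
-- of the two closed forms, and this product is exactly j times the k-th term of the terminating
-- 2F1 series in the m-th summand.

module Submission where

open import Defs
open import Data.Empty using (⊥-elim)
open import Data.Nat as ℕ using (ℕ; zero; suc; _≤_; _<_; _∸_; z≤n; s≤s; _!; _^_)
import Data.Nat.Properties as ℕP
import Data.Integer as ℤ
import Data.Integer.Properties as ℤP
open import Data.Rational as ℚ using (ℚ; mkℚ; 0ℚ; 1ℚ)
import Data.Rational.Properties as ℚP
open import Data.Rational.Unnormalised as ℚᵘ using (mkℚᵘ; *≡*)
import Data.Rational.Unnormalised.Properties as ℚᵘP
import Data.Nat.Coprimality as Coprime
open import Data.Rational.Solver using (module +-*-Solver)
open import Data.Sum using (_⊎_; inj₁; inj₂)
open import Relation.Binary.PropositionalEquality

module RationalArithmetic where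
  open import Data.Integer using (+_)
  open import Data.Rational using (_+_; _*_; _-_)

  private
    toℚᵘ-ℕ→ℚ : ∀ n → ℚ.toℚᵘ (ℕ→ℚ n) ℚᵘ.≃ mkℚᵘ (+ n) 0
    toℚᵘ-ℕ→ℚ n = ℚP.toℚᵘ-fromℚᵘ (mkℚᵘ (+ n) 0)

  ℕ→ℚ-+ : ∀ a b → ℕ→ℚ (a ℕ.+ b) ≡ ℕ→ℚ a + ℕ→ℚ b
  ℕ→ℚ-+ a b = ℚP.toℚᵘ-injective (ℚᵘP.≃-trans (toℚᵘ-ℕ→ℚ (a ℕ.+ b))
    (ℚᵘP.≃-sym (ℚᵘP.≃-trans (ℚP.toℚᵘ-homo-+ (ℕ→ℚ a) (ℕ→ℚ b))
      (ℚᵘP.≃-trans (ℚᵘP.+-cong (toℚᵘ-ℕ→ℚ a) (toℚᵘ-ℕ→ℚ b)) (*≡* cross)))))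
    where
    open ≡-Reasoning
    cross : (+ a ℤ.* + 1 ℤ.+ + b ℤ.* + 1) ℤ.* + 1 ≡ + (a ℕ.+ b) ℤ.* (+ 1 ℤ.* + 1)
    cross = begin
      (+ a ℤ.* + 1 ℤ.+ + b ℤ.* + 1) ℤ.* + 1 ≡⟨ ℤP.*-identityʳ _ ⟩
      + a ℤ.* + 1 ℤ.+ + b ℤ.* + 1           ≡⟨ cong₂ ℤ._+_ (ℤP.*-identityʳ (+ a)) (ℤP.*-identityʳ (+ b)) ⟩
      + a ℤ.+ + b                           ≡⟨ ℤP.pos-+ a b ⟨
      + (a ℕ.+ b)                           ≡⟨ ℤP.*-identityʳ _ ⟨
      + (a ℕ.+ b) ℤ.* (+ 1 ℤ.* + 1)         ∎

  ℕ→ℚ-* : ∀ a b → ℕ→ℚ (a ℕ.* b) ≡ ℕ→ℚ a * ℕ→ℚ b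
  ℕ→ℚ-* a b = ℚP.toℚᵘ-injective (ℚᵘP.≃-trans (toℚᵘ-ℕ→ℚ (a ℕ.* b))
    (ℚᵘP.≃-sym (ℚᵘP.≃-trans (ℚP.toℚᵘ-homo-* (ℕ→ℚ a) (ℕ→ℚ b))
      (ℚᵘP.≃-trans (ℚᵘP.*-cong (toℚᵘ-ℕ→ℚ a) (toℚᵘ-ℕ→ℚ b)) (*≡* cross)))))
    where
    open ≡-Reasoning
    cross : (+ a ℤ.* + b) ℤ.* + 1 ≡ + (a ℕ.* b) ℤ.* (+ 1 ℤ.* + 1)
    cross = begin
      (+ a ℤ.* + b) ℤ.* + 1         ≡⟨ ℤP.*-identityʳ (+ a ℤ.* + b) ⟩
      + a ℤ.* + b                   ≡⟨ ℤP.pos-* a b ⟨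
      + (a ℕ.* b)                   ≡⟨ ℤP.*-identityʳ _ ⟨
      + (a ℕ.* b) ℤ.* (+ 1 ℤ.* + 1) ∎

  *-distribʳ-sub : ∀ c a b → (a - b) * c ≡ a * c - b * c
  *-distribʳ-sub c a b = solve 3 (λ c a b → (a :- b) :* c := a :* c :- b :* c) refl c a b
    where open +-*-Solver

  ℕ→ℚ-^ : ∀ a n → ℕ→ℚ a ^ℚ n ≡ ℕ→ℚ (a ^ n)
  ℕ→ℚ-^ a zero    = refl
  ℕ→ℚ-^ a (suc n) = trans (cong (ℕ→ℚ a *_) (ℕ→ℚ-^ a n)) (sym (ℕ→ℚ-* a (a ^ n)))

  private
    ℕ→ℚ-suc-mkℚ : ∀ n → ℕ→ℚ (suc n) ≡ mkℚ (+ suc n) 0 (Coprime.sym (Coprime.1-coprimeTo (suc n)))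
    ℕ→ℚ-suc-mkℚ n = ℚP.normalize-coprime (Coprime.sym (Coprime.1-coprimeTo (suc n)))

  ÷₀-*-cancel : ∀ p {n} → n ≢ 0 → (p ÷₀ ℕ→ℚ n) * ℕ→ℚ n ≡ p
  ÷₀-*-cancel p {zero}  n≢0 = ⊥-elim (n≢0 refl)
  ÷₀-*-cancel p {suc n} _ rewrite ℕ→ℚ-suc-mkℚ n = begin
      (p * ℚ.1/ q) * q ≡⟨ ℚP.*-assoc p (ℚ.1/ q) q ⟩
      p * (ℚ.1/ q * q) ≡⟨ cong (p *_) (ℚP.*-inverseˡ q) ⟩
      p * 1ℚ           ≡⟨ ℚP.*-identityʳ p ⟩
      p                ∎
    where
    open ≡-Reasoning
    q = mkℚ (+ suc n) 0 (Coprime.sym (Coprime.1-coprimeTo (suc n)))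

  *-÷₀-cancel : ∀ p {n} → n ≢ 0 → (p * ℕ→ℚ n) ÷₀ ℕ→ℚ n ≡ p
  *-÷₀-cancel p {zero}  n≢0 = ⊥-elim (n≢0 refl)
  *-÷₀-cancel p {suc n} _ rewrite ℕ→ℚ-suc-mkℚ n = begin
      (p * q) * ℚ.1/ q ≡⟨ ℚP.*-assoc p q (ℚ.1/ q) ⟩
      p * (q * ℚ.1/ q) ≡⟨ cong (p *_) (ℚP.*-inverseʳ q) ⟩
      p * 1ℚ           ≡⟨ ℚP.*-identityʳ p ⟩
      p                ∎
    where
    open ≡-Reasoning
    q = mkℚ (+ suc n) 0 (Coprime.sym (Coprime.1-coprimeTo (suc n)))

  *-cancelʳ-ℕ→ℚ : ∀ {p q} n → n ≢ 0 → p * ℕ→ℚ n ≡ q * ℕ→ℚ n → p ≡ q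
  *-cancelʳ-ℕ→ℚ {p} {q} n n≢0 eq = begin
      p                      ≡⟨ *-÷₀-cancel p n≢0 ⟨
      (p * ℕ→ℚ n) ÷₀ ℕ→ℚ n ≡⟨ cong (_÷₀ ℕ→ℚ n) eq ⟩
      (q * ℕ→ℚ n) ÷₀ ℕ→ℚ n ≡⟨ *-÷₀-cancel q n≢0 ⟩
      q                      ∎
    where open ≡-Reasoning

module FiniteSums where
  open import Data.Rational using (_+_; _*_; _-_)
  open +-*-Solver

  sumTo-cong : ∀ n {f g : ℕ → ℚ} → (∀ k → k ≤ n → f k ≡ g k) → sumTo n f ≡ sumTo n g
  sumTo-cong zero    f≗g = f≗g 0 z≤n
  sumTo-cong (suc n) f≗g =
    cong₂ _+_ (sumTo-cong n (λ k k≤n → f≗g k (ℕP.m≤n⇒m≤1+n k≤n))) (f≗g (suc n) ℕP.≤-refl)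

  sumTo-+ : ∀ n (f g : ℕ → ℚ) → sumTo n (λ k → f k + g k) ≡ sumTo n f + sumTo n g
  sumTo-+ zero    f g = refl
  sumTo-+ (suc n) f g rewrite sumTo-+ n f g =
    solve 4 (λ a b c d → (a :+ b) :+ (c :+ d) := (a :+ c) :+ (b :+ d)) refl
      (sumTo n f) (sumTo n g) (f (suc n)) (g (suc n))

  sumTo-- : ∀ n (f g : ℕ → ℚ) → sumTo n (λ k → f k - g k) ≡ sumTo n f - sumTo n g
  sumTo-- zero    f g = refl
  sumTo-- (suc n) f g rewrite sumTo-- n f g =
    solve 4 (λ a b c d → (a :- b) :+ (c :- d) := (a :+ c) :- (b :+ d)) refl
      (sumTo n f) (sumTo n g) (f (suc n)) (g (suc n))

  sumTo-*ˡ : ∀ n c (f : ℕ → ℚ) → c * sumTo n f ≡ sumTo n (λ k → c * f k)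
  sumTo-*ˡ zero    c f = refl
  sumTo-*ˡ (suc n) c f rewrite sym (sumTo-*ˡ n c f) = ℚP.*-distribˡ-+ c (sumTo n f) (f (suc n))

  sumTo-*ʳ : ∀ n c (f : ℕ → ℚ) → sumTo n f * c ≡ sumTo n (λ k → f k * c)
  sumTo-*ʳ zero    c f = refl
  sumTo-*ʳ (suc n) c f rewrite sym (sumTo-*ʳ n c f) = ℚP.*-distribʳ-+ c (sumTo n f) (f (suc n))

  sumTo-suc : ∀ n (f : ℕ → ℚ) → sumTo (suc n) f ≡ f 0 + sumTo n (λ k → f (suc k))
  sumTo-suc zero    f = refl
  sumTo-suc (suc n) f rewrite sumTo-suc n f = ℚP.+-assoc (f 0) (sumTo n (λ k → f (suc k))) (f (suc (suc n)))

  sumTo-reverse : ∀ n (f : ℕ → ℚ) → sumTo n f ≡ sumTo n (λ k → f (n ∸ k))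
  sumTo-reverse zero    f = refl
  sumTo-reverse (suc n) f = begin
      sumTo n f + f (suc n)                  ≡⟨ cong (_+ f (suc n)) (sumTo-reverse n f) ⟩
      sumTo n (λ k → f (n ∸ k)) + f (suc n) ≡⟨ ℚP.+-comm _ (f (suc n)) ⟩
      f (suc n) + sumTo n (λ k → f (n ∸ k)) ≡⟨ sumTo-suc n (λ k → f (suc n ∸ k)) ⟨
      sumTo (suc n) (λ k → f (suc n ∸ k))    ∎
    where open ≡-Reasoning

  sumTo-extend : ∀ n (f : ℕ → ℚ) → f (suc n) ≡ 0ℚ → sumTo (suc n) f ≡ sumTo n f
  sumTo-extend n f fₙ₊₁≡0 rewrite fₙ₊₁≡0 = ℚP.+-identityʳ (sumTo n f)

  sumTo-shift : ∀ n (f : ℕ → ℚ) → f (suc n) ≡ 0ℚ → sumTo n f ≡ f 0 + sumTo n (λ k → f (suc k))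
  sumTo-shift n f fₙ₊₁≡0 = trans (sym (sumTo-extend n f fₙ₊₁≡0)) (sumTo-suc n f)

  sumTo-triangle : ∀ h (g : ℕ → ℕ → ℚ) →
    sumTo h (λ s → sumTo s (g s)) ≡ sumTo h (λ m → sumTo m (λ k → g ((h ∸ m) ℕ.+ k) (h ∸ m)))
  sumTo-triangle zero    g = refl
  sumTo-triangle (suc h) g = begin
      sumTo h (λ s → sumTo s (g s)) + (sumTo h (g (suc h)) + G)
        ≡⟨ cong₂ (λ a b → a + (b + G)) (sumTo-triangle h g) (sumTo-reverse h (g (suc h))) ⟩
      Cols + (Diag + G)
        ≡⟨ solve 3 (λ c d g → c :+ (d :+ g) := g :+ (c :+ d)) refl Cols Diag G ⟩
      G + (Cols + Diag)
        ≡⟨ cong (G +_) (sym (sumTo-+ h _ _)) ⟩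
      G + sumTo h (λ m → sumTo m (col m) + g (suc h) (h ∸ m))
        ≡⟨ cong (G +_) (sumTo-cong h (λ m m≤h → cong (λ t → sumTo m (col m) + g t (h ∸ m)) (sym (∸-+-suc m≤h)))) ⟩
      G + sumTo h (λ m → sumTo (suc m) (col m))
        ≡⟨ cong (λ t → g t (suc h) + sumTo h (λ m → sumTo (suc m) (col m))) (sym (ℕP.+-identityʳ (suc h))) ⟩
      g (suc h ℕ.+ 0) (suc h) + sumTo h (λ m → sumTo (suc m) (col m))
        ≡⟨ sumTo-suc h (λ m → sumTo m (λ k → g ((suc h ∸ m) ℕ.+ k) (suc h ∸ m))) ⟨
      sumTo (suc h) (λ m → sumTo m (λ k → g ((suc h ∸ m) ℕ.+ k) (suc h ∸ m))) ∎
    where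
    open ≡-Reasoning
    col : ℕ → ℕ → ℚ
    col m k = g ((h ∸ m) ℕ.+ k) (h ∸ m)
    G    = g (suc h) (suc h)
    Cols = sumTo h (λ m → sumTo m (col m))
    Diag = sumTo h (λ m → g (suc h) (h ∸ m))
    ∸-+-suc : ∀ {m} → m ≤ h → (h ∸ m) ℕ.+ suc m ≡ suc h
    ∸-+-suc {m} m≤h = trans (ℕP.+-suc (h ∸ m) m) (cong suc (ℕP.m∸n+n≡m m≤h))

module FibonacciExpansion where
  open import Data.Rational using (_+_; _*_; _-_; -_)
  open +-*-Solver
  open RationalArithmetic
  open FiniteSums

  -- fibCoeff₀ s r is the coefficient of F_{2r+1} in x^{2s}, and fibCoeff₁ s r that of F_{2r+2}
  -- in x^{2s+1}; the recursion is multiplication by x, using x F_{n+1} = F_{n+2} - F_n.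
  mutual
    fibCoeff₀ : ℕ → ℕ → ℚ
    fibCoeff₀ zero    zero    = 1ℚ
    fibCoeff₀ zero    (suc r) = 0ℚ
    fibCoeff₀ (suc s) zero    = - fibCoeff₁ s 0
    fibCoeff₀ (suc s) (suc r) = fibCoeff₁ s r - fibCoeff₁ s (suc r)

    fibCoeff₁ : ℕ → ℕ → ℚ
    fibCoeff₁ s r = fibCoeff₀ s r - fibCoeff₀ s (suc r)

  mutual
    fibCoeff₀-vanish : ∀ {s r} → s < r → fibCoeff₀ s r ≡ 0ℚ
    fibCoeff₀-vanish {zero}  {suc r} _ = refl
    fibCoeff₀-vanish {suc s} {suc r} (s≤s s<r)
      rewrite fibCoeff₁-vanish s<r | fibCoeff₁-vanish (ℕP.m<n⇒m<1+n s<r) = refl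

    fibCoeff₁-vanish : ∀ {s r} → s < r → fibCoeff₁ s r ≡ 0ℚ
    fibCoeff₁-vanish s<r rewrite fibCoeff₀-vanish s<r | fibCoeff₀-vanish (ℕP.m<n⇒m<1+n s<r) = refl

  module _ (x : ℚ) where
    private
      F : ℕ → ℚ
      F n = fibPoly n x

      x-*-F : ∀ b n → x * (b * F (suc n)) ≡ b * F (suc (suc n)) - b * F n
      x-*-F b n = solve 4 (λ x b a c → x :* (b :* a) := b :* (x :* a :+ c) :- b :* c) refl x b (F (suc n)) (F n)

    mutual
      ^-fibExpansion₀ : ∀ s → x ^ℚ (2 ℕ.* s) ≡ sumTo s (λ r → fibCoeff₀ s r * F (suc (2 ℕ.* r)))
      ^-fibExpansion₀ zero    = refl
      ^-fibExpansion₀ (suc s) = begin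
          x ^ℚ (2 ℕ.* suc s)
            ≡⟨ cong (x ^ℚ_) (ℕP.*-suc 2 s) ⟩
          x * x ^ℚ suc (2 ℕ.* s)
            ≡⟨ cong (x *_) (^-fibExpansion₁ s) ⟩
          x * sumTo s (λ r → b r * F (suc (suc (2 ℕ.* r))))
            ≡⟨ sumTo-*ˡ s x _ ⟩
          sumTo s (λ r → x * (b r * F (suc (suc (2 ℕ.* r)))))
            ≡⟨ sumTo-cong s (λ r _ → trans (x-*-F (b r) (suc (2 ℕ.* r)))
                                           (cong (λ n → b r * F (suc n) - b r * F (suc (2 ℕ.* r))) (sym (ℕP.*-suc 2 r)))) ⟩
          sumTo s (λ r → b r * F (suc (2 ℕ.* suc r)) - b r * F (suc (2 ℕ.* r)))
            ≡⟨ sumTo-- s _ _ ⟩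
          Up - sumTo s (λ r → b r * F (suc (2 ℕ.* r)))
            ≡⟨ cong (_-_ Up) (sumTo-shift s (λ r → b r * F (suc (2 ℕ.* r))) top-vanishes) ⟩
          Up - (b 0 * 1ℚ + Down)
            ≡⟨ solve 3 (λ b p q → p :- (b :* con 1ℚ :+ q) := (:- b) :* con 1ℚ :+ (p :- q)) refl (b 0) Up Down ⟩
          (- b 0) * 1ℚ + (Up - Down)
            ≡⟨ cong ((- b 0) * 1ℚ +_) (sym (sumTo-- s _ _)) ⟩
          (- b 0) * 1ℚ + sumTo s (λ r → b r * F (suc (2 ℕ.* suc r)) - b (suc r) * F (suc (2 ℕ.* suc r)))
            ≡⟨ cong ((- b 0) * 1ℚ +_) (sumTo-cong s (λ r _ → sym (*-distribʳ-sub (F (suc (2 ℕ.* suc r))) (b r) (b (suc r))))) ⟩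
          fibCoeff₀ (suc s) 0 * F 1 + sumTo s (λ r → fibCoeff₀ (suc s) (suc r) * F (suc (2 ℕ.* suc r)))
            ≡⟨ sumTo-suc s (λ r → fibCoeff₀ (suc s) r * F (suc (2 ℕ.* r))) ⟨
          sumTo (suc s) (λ r → fibCoeff₀ (suc s) r * F (suc (2 ℕ.* r))) ∎
        where
        open ≡-Reasoning
        b = fibCoeff₁ s
        Up   = sumTo s (λ r → b r * F (suc (2 ℕ.* suc r)))
        Down = sumTo s (λ r → b (suc r) * F (suc (2 ℕ.* suc r)))
        top-vanishes : b (suc s) * F (suc (2 ℕ.* suc s)) ≡ 0ℚ
        top-vanishes rewrite fibCoeff₁-vanish (ℕP.n<1+n s) = ℚP.*-zeroˡ (F (suc (2 ℕ.* suc s)))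

      ^-fibExpansion₁ : ∀ s → x ^ℚ suc (2 ℕ.* s) ≡ sumTo s (λ r → fibCoeff₁ s r * F (suc (suc (2 ℕ.* r))))
      ^-fibExpansion₁ s = begin
          x * x ^ℚ (2 ℕ.* s)
            ≡⟨ cong (x *_) (^-fibExpansion₀ s) ⟩
          x * sumTo s (λ r → b r * F (suc (2 ℕ.* r)))
            ≡⟨ sumTo-*ˡ s x _ ⟩
          sumTo s (λ r → x * (b r * F (suc (2 ℕ.* r))))
            ≡⟨ sumTo-cong s (λ r _ → x-*-F (b r) (2 ℕ.* r)) ⟩
          sumTo s (λ r → b r * F (suc (suc (2 ℕ.* r))) - b r * F (2 ℕ.* r))
            ≡⟨ sumTo-- s _ _ ⟩
          Up - sumTo s (λ r → b r * F (2 ℕ.* r))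
            ≡⟨ cong (_-_ Up) (sumTo-shift s (λ r → b r * F (2 ℕ.* r)) top-vanishes) ⟩
          Up - (b 0 * 0ℚ + Down)
            ≡⟨ solve 3 (λ b p q → p :- (b :* con 0ℚ :+ q) := p :- q) refl (b 0) Up Down ⟩
          Up - Down
            ≡⟨ sumTo-- s _ _ ⟨
          sumTo s (λ r → b r * F (suc (suc (2 ℕ.* r))) - b (suc r) * F (2 ℕ.* suc r))
            ≡⟨ sumTo-cong s (λ r _ → trans (cong (λ n → b r * F (suc (suc (2 ℕ.* r))) - b (suc r) * F n) (ℕP.*-suc 2 r))
                                           (sym (*-distribʳ-sub (F (suc (suc (2 ℕ.* r)))) (b r) (b (suc r))))) ⟩
          sumTo s (λ r → fibCoeff₁ s r * F (suc (suc (2 ℕ.* r)))) ∎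
        where
        open ≡-Reasoning
        b = fibCoeff₀ s
        Up   = sumTo s (λ r → b r * F (suc (suc (2 ℕ.* r))))
        Down = sumTo s (λ r → b (suc r) * F (2 ℕ.* suc r))
        top-vanishes : b (suc s) * F (2 ℕ.* suc s) ≡ 0ℚ
        top-vanishes rewrite fibCoeff₀-vanish (ℕP.n<1+n s) = ℚP.*-zeroˡ (F (2 ℕ.* suc s))

module ChebyshevExpansion where
  open import Data.Rational using (_+_; _*_; _-_; -_)
  open +-*-Solver
  open FiniteSums

  -- chebCoeff₀ h s is the coefficient of x^{2s} in T_{2h}, and chebCoeff₁ h s that of x^{2s+1}
  -- in T_{2h+1}, following T_{n+2} = 2x T_{n+1} - T_n.
  mutual
    chebCoeff₀ : ℕ → ℕ → ℚ
    chebCoeff₀ zero    zero    = 1ℚ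
    chebCoeff₀ zero    (suc s) = 0ℚ
    chebCoeff₀ (suc h) zero    = - chebCoeff₀ h 0
    chebCoeff₀ (suc h) (suc s) = ℕ→ℚ 2 * chebCoeff₁ h s - chebCoeff₀ h (suc s)

    chebCoeff₁ : ℕ → ℕ → ℚ
    chebCoeff₁ zero    zero    = 1ℚ
    chebCoeff₁ zero    (suc s) = 0ℚ
    chebCoeff₁ (suc h) s       = ℕ→ℚ 2 * chebCoeff₀ (suc h) s - chebCoeff₁ h s

  mutual
    chebCoeff₀-vanish : ∀ {h s} → h < s → chebCoeff₀ h s ≡ 0ℚ
    chebCoeff₀-vanish {zero}  {suc s} _ = refl
    chebCoeff₀-vanish {suc h} {suc s} (s≤s h<s)
      rewrite chebCoeff₁-vanish h<s | chebCoeff₀-vanish (ℕP.m<n⇒m<1+n h<s) = refl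

    chebCoeff₁-vanish : ∀ {h s} → h < s → chebCoeff₁ h s ≡ 0ℚ
    chebCoeff₁-vanish {zero}  {suc s} _ = refl
    chebCoeff₁-vanish {suc h} h<s
      rewrite chebCoeff₀-vanish h<s | chebCoeff₁-vanish (ℕP.<-trans (ℕP.n<1+n h) h<s) = refl

  module _ (x : ℚ) where
    private
      X : ℕ → ℚ
      X n = x ^ℚ n

      2x-*-X : ∀ c d n → (ℕ→ℚ 2 * x) * (c * X n) - d * X (suc n) ≡ (ℕ→ℚ 2 * c - d) * X (suc n)
      2x-*-X c d n = solve 5 (λ t x c d y → (t :* x) :* (c :* y) :- d :* (x :* y) := (t :* c :- d) :* (x :* y))
                       refl (ℕ→ℚ 2) x c d (X n)

    mutual
      cheb-powExpansion₀ : ∀ h → cheb (2 ℕ.* h) x ≡ sumTo h (λ s → chebCoeff₀ h s * X (2 ℕ.* s))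
      cheb-powExpansion₀ zero    = refl
      cheb-powExpansion₀ (suc h) = begin
          cheb (2 ℕ.* suc h) x
            ≡⟨ cong (λ n → cheb n x) (ℕP.*-suc 2 h) ⟩
          (ℕ→ℚ 2 * x) * cheb (suc (2 ℕ.* h)) x - cheb (2 ℕ.* h) x
            ≡⟨ cong₂ (λ a b → (ℕ→ℚ 2 * x) * a - b) (cheb-powExpansion₁ h) (cheb-powExpansion₀ h) ⟩
          (ℕ→ℚ 2 * x) * sumTo h (λ s → c s * X (suc (2 ℕ.* s))) - sumTo h (λ s → d s * X (2 ℕ.* s))
            ≡⟨ cong₂ _-_ (sumTo-*ˡ h (ℕ→ℚ 2 * x) _) (sumTo-shift h (λ s → d s * X (2 ℕ.* s)) top-vanishes) ⟩
          Up - (d 0 * 1ℚ + Down)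
            ≡⟨ solve 3 (λ c p q → p :- (c :* con 1ℚ :+ q) := (:- c) :* con 1ℚ :+ (p :- q)) refl (d 0) Up Down ⟩
          (- d 0) * 1ℚ + (Up - Down)
            ≡⟨ cong ((- d 0) * 1ℚ +_) (sym (sumTo-- h _ _)) ⟩
          (- d 0) * 1ℚ + sumTo h (λ s → (ℕ→ℚ 2 * x) * (c s * X (suc (2 ℕ.* s))) - d (suc s) * X (2 ℕ.* suc s))
            ≡⟨ cong ((- d 0) * 1ℚ +_) (sumTo-cong h (λ s _ → step s)) ⟩
          chebCoeff₀ (suc h) 0 * X 0 + sumTo h (λ s → chebCoeff₀ (suc h) (suc s) * X (2 ℕ.* suc s))
            ≡⟨ sumTo-suc h (λ s → chebCoeff₀ (suc h) s * X (2 ℕ.* s)) ⟨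
          sumTo (suc h) (λ s → chebCoeff₀ (suc h) s * X (2 ℕ.* s)) ∎
        where
        open ≡-Reasoning
        c = chebCoeff₁ h
        d = chebCoeff₀ h
        Up   = sumTo h (λ s → (ℕ→ℚ 2 * x) * (c s * X (suc (2 ℕ.* s))))
        Down = sumTo h (λ s → d (suc s) * X (2 ℕ.* suc s))
        top-vanishes : d (suc h) * X (2 ℕ.* suc h) ≡ 0ℚ
        top-vanishes rewrite chebCoeff₀-vanish (ℕP.n<1+n h) = ℚP.*-zeroˡ (X (2 ℕ.* suc h))
        step : ∀ s → (ℕ→ℚ 2 * x) * (c s * X (suc (2 ℕ.* s))) - d (suc s) * X (2 ℕ.* suc s)
                     ≡ chebCoeff₀ (suc h) (suc s) * X (2 ℕ.* suc s)
        step s = subst (λ n → (ℕ→ℚ 2 * x) * (c s * X (suc (2 ℕ.* s))) - d (suc s) * X n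
                              ≡ chebCoeff₀ (suc h) (suc s) * X n)
                       (sym (ℕP.*-suc 2 s)) (2x-*-X (c s) (d (suc s)) (suc (2 ℕ.* s)))

      cheb-powExpansion₁ : ∀ h → cheb (suc (2 ℕ.* h)) x ≡ sumTo h (λ s → chebCoeff₁ h s * X (suc (2 ℕ.* s)))
      cheb-powExpansion₁ zero    = solve 1 (λ x → x := con 1ℚ :* (x :* con 1ℚ)) refl x
      cheb-powExpansion₁ (suc h) = begin
          cheb (suc (2 ℕ.* suc h)) x
            ≡⟨ cong (λ n → cheb (suc n) x) (ℕP.*-suc 2 h) ⟩
          (ℕ→ℚ 2 * x) * cheb (suc (suc (2 ℕ.* h))) x - cheb (suc (2 ℕ.* h)) x
            ≡⟨ cong₂ (λ a b → (ℕ→ℚ 2 * x) * a - b)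
                     (trans (cong (λ n → cheb n x) (sym (ℕP.*-suc 2 h))) (cheb-powExpansion₀ (suc h)))
                     (cheb-powExpansion₁ h) ⟩
          (ℕ→ℚ 2 * x) * sumTo (suc h) (λ s → d s * X (2 ℕ.* s)) - sumTo h (λ s → c s * X (suc (2 ℕ.* s)))
            ≡⟨ cong₂ _-_ (sumTo-*ˡ (suc h) (ℕ→ℚ 2 * x) _)
                         (sym (sumTo-extend h (λ s → c s * X (suc (2 ℕ.* s))) top-vanishes)) ⟩
          sumTo (suc h) (λ s → (ℕ→ℚ 2 * x) * (d s * X (2 ℕ.* s))) - sumTo (suc h) (λ s → c s * X (suc (2 ℕ.* s)))
            ≡⟨ sumTo-- (suc h) _ _ ⟨
          sumTo (suc h) (λ s → (ℕ→ℚ 2 * x) * (d s * X (2 ℕ.* s)) - c s * X (suc (2 ℕ.* s)))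
            ≡⟨ sumTo-cong (suc h) (λ s _ → 2x-*-X (d s) (c s) (2 ℕ.* s)) ⟩
          sumTo (suc h) (λ s → chebCoeff₁ (suc h) s * X (suc (2 ℕ.* s))) ∎
        where
        open ≡-Reasoning
        c = chebCoeff₁ h
        d = chebCoeff₀ (suc h)
        top-vanishes : c (suc h) * X (suc (2 ℕ.* suc h)) ≡ 0ℚ
        top-vanishes rewrite chebCoeff₁-vanish (ℕP.n<1+n h) = ℚP.*-zeroˡ (X (suc (2 ℕ.* suc h)))

module Factorials where
  open import Data.Nat using (_*_)

  !-suc : ∀ {a b} → a ≡ suc b → a ! ≡ a * b !
  !-suc refl = refl

  !≢0 : ∀ n → n ! ≢ 0
  !≢0 n = ℕ.≢-nonZero⁻¹ (n !) {{ℕP._!≢0 n}}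

  *-≢0 : ∀ {a b} → a ≢ 0 → b ≢ 0 → a * b ≢ 0
  *-≢0 {a} a≢0 b≢0 ab≡0 with ℕP.m*n≡0⇒m≡0∨n≡0 a ab≡0
  ... | inj₁ a≡0 = a≢0 a≡0
  ... | inj₂ b≡0 = b≢0 b≡0

module SignedRatios where
  open import Data.Rational using (_+_; _*_; _-_; -_)
  open +-*-Solver
  open RationalArithmetic

  sign : ℕ → ℚ
  sign k = (- 1ℚ) ^ℚ k

  infix 4 _≐_⟨_/_⟩

  -- X ≐ s ⟨ N / D ⟩ means X = s · N / D with the division cleared (so it is vacuous when D = 0).
  record _≐_⟨_/_⟩ (X s : ℚ) (N D : ℕ) : Set where
    constructor cross
    field cross-≡ : X * ℕ→ℚ D ≡ s * ℕ→ℚ N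

  private
    variable
      X Y s t : ℚ
      N N₁ N₂ D D₁ D₂ : ℕ

  ≐-cong : X ≡ Y → X ≐ s ⟨ N / D ⟩ → Y ≐ s ⟨ N / D ⟩
  ≐-cong refl h = h

  ≐-rescale : ∀ α → D ≡ D₁ ℕ.* α → N ≡ N₁ ℕ.* α → X ≐ s ⟨ N₁ / D₁ ⟩ → X ≐ s ⟨ N / D ⟩
  ≐-rescale {D} {D₁} {N} {N₁} {X} {s} α refl refl (cross h) = cross (begin
      X * ℕ→ℚ (D₁ ℕ.* α)       ≡⟨ cong (X *_) (ℕ→ℚ-* D₁ α) ⟩
      X * (ℕ→ℚ D₁ * ℕ→ℚ α)    ≡⟨ ℚP.*-assoc X _ _ ⟨
      (X * ℕ→ℚ D₁) * ℕ→ℚ α    ≡⟨ cong (_* ℕ→ℚ α) h ⟩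
      (s * ℕ→ℚ N₁) * ℕ→ℚ α    ≡⟨ ℚP.*-assoc s _ _ ⟩
      s * (ℕ→ℚ N₁ * ℕ→ℚ α)    ≡⟨ cong (s *_) (ℕ→ℚ-* N₁ α) ⟨
      s * ℕ→ℚ (N₁ ℕ.* α)       ∎)
    where open ≡-Reasoning

  ≐-cancel : ∀ γ → γ ≢ 0 → X ≐ s ⟨ N ℕ.* γ / D ℕ.* γ ⟩ → X ≐ s ⟨ N / D ⟩
  ≐-cancel {X} {s} {N} {D} γ γ≢0 (cross h) = cross (*-cancelʳ-ℕ→ℚ γ γ≢0 (begin
      (X * ℕ→ℚ D) * ℕ→ℚ γ  ≡⟨ ℚP.*-assoc X _ _ ⟩
      X * (ℕ→ℚ D * ℕ→ℚ γ)  ≡⟨ cong (X *_) (ℕ→ℚ-* D γ) ⟨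
      X * ℕ→ℚ (D ℕ.* γ)     ≡⟨ h ⟩
      s * ℕ→ℚ (N ℕ.* γ)     ≡⟨ cong (s *_) (ℕ→ℚ-* N γ) ⟩
      s * (ℕ→ℚ N * ℕ→ℚ γ)  ≡⟨ ℚP.*-assoc s _ _ ⟨
      (s * ℕ→ℚ N) * ℕ→ℚ γ  ∎))
    where open ≡-Reasoning

  ≐-neg : X ≐ s ⟨ N / D ⟩ → - X ≐ (- 1ℚ) * s ⟨ N / D ⟩
  ≐-neg {X} {s} {N} {D} (cross h) = cross (begin
      (- X) * ℕ→ℚ D            ≡⟨ solve 2 (λ X d → (:- X) :* d := con (- 1ℚ) :* (X :* d)) refl X (ℕ→ℚ D) ⟩
      (- 1ℚ) * (X * ℕ→ℚ D)    ≡⟨ cong ((- 1ℚ) *_) h ⟩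
      (- 1ℚ) * (s * ℕ→ℚ N)    ≡⟨ ℚP.*-assoc (- 1ℚ) s _ ⟨
      ((- 1ℚ) * s) * ℕ→ℚ N    ∎)
    where open ≡-Reasoning

  ≐-*ℕ : ∀ a → X ≐ s ⟨ N / D ⟩ → ℕ→ℚ a * X ≐ s ⟨ a ℕ.* N / D ⟩
  ≐-*ℕ {X} {s} {N} {D} a (cross h) = cross (begin
      (ℕ→ℚ a * X) * ℕ→ℚ D    ≡⟨ ℚP.*-assoc (ℕ→ℚ a) X _ ⟩
      ℕ→ℚ a * (X * ℕ→ℚ D)    ≡⟨ cong (ℕ→ℚ a *_) h ⟩
      ℕ→ℚ a * (s * ℕ→ℚ N)    ≡⟨ solve 3 (λ a s n → a :* (s :* n) := s :* (a :* n)) refl (ℕ→ℚ a) s (ℕ→ℚ N) ⟩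
      s * (ℕ→ℚ a * ℕ→ℚ N)    ≡⟨ cong (s *_) (ℕ→ℚ-* a N) ⟨
      s * ℕ→ℚ (a ℕ.* N)       ∎)
    where open ≡-Reasoning

  ℕ→ℚ-≐ : ∀ a → ℕ→ℚ a ≐ 1ℚ ⟨ a / 1 ⟩
  ℕ→ℚ-≐ a = cross (trans (ℚP.*-identityʳ (ℕ→ℚ a)) (sym (ℚP.*-identityˡ (ℕ→ℚ a))))

  ≐-*ˡ : ∀ c → X ≐ s ⟨ N / D ⟩ → c * X ≐ c * s ⟨ N / D ⟩
  ≐-*ˡ {X} {s} {N} {D} c (cross h) = cross (begin
      (c * X) * ℕ→ℚ D   ≡⟨ ℚP.*-assoc c X _ ⟩
      c * (X * ℕ→ℚ D)   ≡⟨ cong (c *_) h ⟩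
      c * (s * ℕ→ℚ N)   ≡⟨ ℚP.*-assoc c s _ ⟨
      (c * s) * ℕ→ℚ N   ∎)
    where open ≡-Reasoning

  ≐-sub : X ≐ (- 1ℚ) * t ⟨ N₁ / D ⟩ → Y ≐ t ⟨ N₂ / D ⟩ → X - Y ≐ (- 1ℚ) * t ⟨ N₁ ℕ.+ N₂ / D ⟩
  ≐-sub {X} {t} {N₁} {D} {Y} {N₂} (cross hX) (cross hY) = cross (begin
      (X - Y) * ℕ→ℚ D                        ≡⟨ *-distribʳ-sub (ℕ→ℚ D) X Y ⟩
      X * ℕ→ℚ D - Y * ℕ→ℚ D                 ≡⟨ cong₂ _-_ hX hY ⟩
      ((- 1ℚ) * t) * ℕ→ℚ N₁ - t * ℕ→ℚ N₂   ≡⟨ solve 3 (λ t a b → (con (- 1ℚ) :* t) :* a :- t :* b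
                                                              := (con (- 1ℚ) :* t) :* (a :+ b)) refl t (ℕ→ℚ N₁) (ℕ→ℚ N₂) ⟩
      ((- 1ℚ) * t) * (ℕ→ℚ N₁ + ℕ→ℚ N₂)     ≡⟨ cong (((- 1ℚ) * t) *_) (ℕ→ℚ-+ N₁ N₂) ⟨
      ((- 1ℚ) * t) * ℕ→ℚ (N₁ ℕ.+ N₂)        ∎)
    where open ≡-Reasoning

  ≐-sub-vanishing : Y ≡ 0ℚ → X ≐ s ⟨ N / D ⟩ → X - Y ≐ s ⟨ N / D ⟩
  ≐-sub-vanishing {X = X} refl = ≐-cong (sym (ℚP.+-identityʳ X))

  ≐-combine : ∀ α β → D ≡ D₁ ℕ.* α → D ≡ D₂ ℕ.* β → N ≡ N₁ ℕ.* α ℕ.+ N₂ ℕ.* β →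
              X ≐ (- 1ℚ) * t ⟨ N₁ / D₁ ⟩ → Y ≐ t ⟨ N₂ / D₂ ⟩ → X - Y ≐ (- 1ℚ) * t ⟨ N / D ⟩
  ≐-combine {D = D} {X = X} {t = t} {Y = Y} α β eD₁ eD₂ eN hX hY =
    subst (λ n → X - Y ≐ (- 1ℚ) * t ⟨ n / D ⟩) (sym eN) (≐-sub (≐-rescale α eD₁ refl hX) (≐-rescale β eD₂ refl hY))

  ≐-* : X ≐ s ⟨ N₁ / D₁ ⟩ → Y ≐ t ⟨ N₂ / D₂ ⟩ → X * Y ≐ s * t ⟨ N₁ ℕ.* N₂ / D₁ ℕ.* D₂ ⟩
  ≐-* {X} {s} {N₁} {D₁} {Y} {t} {N₂} {D₂} (cross hX) (cross hY) = cross (begin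
      (X * Y) * ℕ→ℚ (D₁ ℕ.* D₂)           ≡⟨ cong ((X * Y) *_) (ℕ→ℚ-* D₁ D₂) ⟩
      (X * Y) * (ℕ→ℚ D₁ * ℕ→ℚ D₂)        ≡⟨ interchange X Y (ℕ→ℚ D₁) (ℕ→ℚ D₂) ⟩
      (X * ℕ→ℚ D₁) * (Y * ℕ→ℚ D₂)        ≡⟨ cong₂ _*_ hX hY ⟩
      (s * ℕ→ℚ N₁) * (t * ℕ→ℚ N₂)        ≡⟨ interchange s (ℕ→ℚ N₁) t (ℕ→ℚ N₂) ⟩
      (s * t) * (ℕ→ℚ N₁ * ℕ→ℚ N₂)        ≡⟨ cong ((s * t) *_) (ℕ→ℚ-* N₁ N₂) ⟨
      (s * t) * ℕ→ℚ (N₁ ℕ.* N₂)           ∎)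
    where
    open ≡-Reasoning
    interchange : ∀ a b c d → (a * b) * (c * d) ≡ (a * c) * (b * d)
    interchange = solve 4 (λ a b c d → (a :* b) :* (c :* d) := (a :* c) :* (b :* d)) refl

  ≐-÷₀ : ∀ d → d ≢ 0 → X ≐ s ⟨ N / D ⟩ → X ÷₀ ℕ→ℚ d ≐ s ⟨ N / d ℕ.* D ⟩
  ≐-÷₀ {X} {s} {N} {D} d d≢0 (cross h) = cross (begin
      (X ÷₀ ℕ→ℚ d) * ℕ→ℚ (d ℕ.* D)        ≡⟨ cong ((X ÷₀ ℕ→ℚ d) *_) (ℕ→ℚ-* d D) ⟩
      (X ÷₀ ℕ→ℚ d) * (ℕ→ℚ d * ℕ→ℚ D)     ≡⟨ ℚP.*-assoc (X ÷₀ ℕ→ℚ d) (ℕ→ℚ d) (ℕ→ℚ D) ⟨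
      ((X ÷₀ ℕ→ℚ d) * ℕ→ℚ d) * ℕ→ℚ D     ≡⟨ cong (_* ℕ→ℚ D) (÷₀-*-cancel X d≢0) ⟩
      X * ℕ→ℚ D                           ≡⟨ h ⟩
      s * ℕ→ℚ N                           ∎)
    where open ≡-Reasoning

  ≐-unique : ∀ {N′ D′} → D ≢ 0 → D′ ≢ 0 → N ℕ.* D′ ≡ N′ ℕ.* D →
             X ≐ s ⟨ N / D ⟩ → Y ≐ s ⟨ N′ / D′ ⟩ → X ≡ Y
  ≐-unique {D} {N} {X} {s} {Y} {N′} {D′} D≢0 D′≢0 eN (cross hX) (cross hY) =
    *-cancelʳ-ℕ→ℚ (D ℕ.* D′) (Factorials.*-≢0 D≢0 D′≢0) (begin
      X * ℕ→ℚ (D ℕ.* D′)             ≡⟨ cong (X *_) (ℕ→ℚ-* D D′) ⟩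
      X * (ℕ→ℚ D * ℕ→ℚ D′)          ≡⟨ ℚP.*-assoc X _ _ ⟨
      (X * ℕ→ℚ D) * ℕ→ℚ D′          ≡⟨ cong (_* ℕ→ℚ D′) hX ⟩
      (s * ℕ→ℚ N) * ℕ→ℚ D′          ≡⟨ ℚP.*-assoc s _ _ ⟩
      s * (ℕ→ℚ N * ℕ→ℚ D′)          ≡⟨ cong (s *_) (trans (sym (ℕ→ℚ-* N D′)) (trans (cong ℕ→ℚ eN) (ℕ→ℚ-* N′ D))) ⟩
      s * (ℕ→ℚ N′ * ℕ→ℚ D)          ≡⟨ ℚP.*-assoc s _ _ ⟨
      (s * ℕ→ℚ N′) * ℕ→ℚ D          ≡⟨ cong (_* ℕ→ℚ D) hY ⟨
      (Y * ℕ→ℚ D′) * ℕ→ℚ D          ≡⟨ ℚP.*-assoc Y _ _ ⟩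
      Y * (ℕ→ℚ D′ * ℕ→ℚ D)          ≡⟨ cong (Y *_) (ℚP.*-comm (ℕ→ℚ D′) (ℕ→ℚ D)) ⟩
      Y * (ℕ→ℚ D * ℕ→ℚ D′)          ≡⟨ cong (Y *_) (ℕ→ℚ-* D D′) ⟨
      Y * ℕ→ℚ (D ℕ.* D′)             ∎)
    where open ≡-Reasoning

module FibonacciCoefficients where
  open import Data.Nat using (_+_; _*_)
  open import Data.Nat.Tactic.RingSolver using (solve-∀)
  open FibonacciExpansion
  open SignedRatios
  open Factorials

  fibCoeffNum fibCoeffDen : ℕ → ℕ → ℕ
  fibCoeffNum n k = (n + 2 * k) ! * (n + 1)
  fibCoeffDen n k = k ! * (n + k + 1) !

  mutual
    fibCoeff₀-closed : ∀ k r → fibCoeff₀ (r + k) r ≐ sign k ⟨ fibCoeffNum (2 * r) k / fibCoeffDen (2 * r) k ⟩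
    fibCoeff₀-closed zero    zero    = cross refl
    fibCoeff₀-closed (suc k) zero    = ≐-rescale (suc k) eD eN (≐-neg (fibCoeff₁-closed k 0))
      where
      lD : ∀ k a b → suc k * a * b ≡ a * b * suc k
      lD = solve-∀
      eD : fibCoeffDen 0 (suc k) ≡ fibCoeffDen 1 k * suc k
      eD = lD k (k !) ((suc k + 1) !)
      lN : ∀ k a → suc (suc (2 * k)) * a * 1 ≡ a * 2 * suc k
      lN = solve-∀
      eN : fibCoeffNum 0 (suc k) ≡ fibCoeffNum 1 k * suc k
      eN = trans (cong (λ z → z ! * 1) (ℕP.*-suc 2 k)) (lN k ((suc (2 * k)) !))
    fibCoeff₀-closed zero    (suc r) =
      ≐-sub-vanishing (fibCoeff₁-vanish (s≤s (ℕP.≤-reflexive (ℕP.+-identityʳ r))))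
        (≐-rescale (2 * suc r + 0 + 1) eD eN (fibCoeff₁-closed 0 r))
      where
      i : ∀ r → 2 * suc r + 0 + 1 ≡ suc (suc (2 * r) + 0 + 1)
      i = solve-∀
      lD : ∀ a b → 1 * (a * b) ≡ 1 * b * a
      lD = solve-∀
      eD : fibCoeffDen (2 * suc r) 0 ≡ fibCoeffDen (suc (2 * r)) 0 * (2 * suc r + 0 + 1)
      eD = trans (cong (1 *_) (!-suc (i r))) (lD (2 * suc r + 0 + 1) ((suc (2 * r) + 0 + 1) !))
      i′ : ∀ r → 2 * suc r + 2 * 0 ≡ suc (suc (2 * r) + 2 * 0)
      i′ = solve-∀
      lN : ∀ r b → (2 * suc r + 2 * 0) * b * (2 * suc r + 1) ≡ b * (suc (2 * r) + 1) * (2 * suc r + 0 + 1)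
      lN = solve-∀
      eN : fibCoeffNum (2 * suc r) 0 ≡ fibCoeffNum (suc (2 * r)) 0 * (2 * suc r + 0 + 1)
      eN = trans (cong (_* (2 * suc r + 1)) (!-suc (i′ r))) (lN r ((suc (2 * r) + 2 * 0) !))
    fibCoeff₀-closed (suc k) (suc r) =
      ≐-combine (2 * suc r + suc k + 1) (suc k) eD₁ eD₂ eN
        (fibCoeff₁-closed (suc k) r)
        (≐-cong (cong (λ z → fibCoeff₁ z (suc r)) (sym (ℕP.+-suc r k))) (fibCoeff₁-closed k (suc r)))
      where
      i₁ : ∀ r k → 2 * suc r + suc k + 1 ≡ suc (suc (2 * r) + suc k + 1)
      i₁ = solve-∀
      i₂ : ∀ r k → suc (2 * suc r) + k + 1 ≡ suc (suc (2 * r) + suc k + 1)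
      i₂ = solve-∀
      l₁ : ∀ f a α → f * (α * a) ≡ f * a * α
      l₁ = solve-∀
      eD₁ : fibCoeffDen (2 * suc r) (suc k) ≡ fibCoeffDen (suc (2 * r)) (suc k) * (2 * suc r + suc k + 1)
      eD₁ = trans (cong ((suc k) ! *_) (!-suc (i₁ r k))) (l₁ ((suc k) !) ((suc (2 * r) + suc k + 1) !) (2 * suc r + suc k + 1))
      l₂ : ∀ r k f a → suc k * f * ((2 * suc r + suc k + 1) * a) ≡ f * ((suc (2 * suc r) + k + 1) * a) * suc k
      l₂ = solve-∀
      eD₂ : fibCoeffDen (2 * suc r) (suc k) ≡ fibCoeffDen (suc (2 * suc r)) k * suc k
      eD₂ = trans (cong ((suc k) ! *_) (!-suc (i₁ r k)))
              (trans (l₂ r k (k !) ((suc (2 * r) + suc k + 1) !)) (cong (λ z → k ! * z * suc k) (sym (!-suc (i₂ r k)))))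
      i₃ : ∀ r k → 2 * suc r + 2 * suc k ≡ suc (suc (2 * r) + 2 * suc k)
      i₃ = solve-∀
      i₄ : ∀ r k → suc (2 * suc r) + 2 * k ≡ suc (2 * r) + 2 * suc k
      i₄ = solve-∀
      l₃ : ∀ r k m → (2 * suc r + 2 * suc k) * m * (2 * suc r + 1)
                     ≡ m * (suc (2 * r) + 1) * (2 * suc r + suc k + 1) + m * (suc (2 * suc r) + 1) * suc k
      l₃ = solve-∀
      eN : fibCoeffNum (2 * suc r) (suc k)
           ≡ fibCoeffNum (suc (2 * r)) (suc k) * (2 * suc r + suc k + 1) + fibCoeffNum (suc (2 * suc r)) k * suc k
      eN = trans (cong (_* (2 * suc r + 1)) (!-suc (i₃ r k)))
             (trans (l₃ r k ((suc (2 * r) + 2 * suc k) !))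
               (cong (λ z → fibCoeffNum (suc (2 * r)) (suc k) * (2 * suc r + suc k + 1) + z ! * (suc (2 * suc r) + 1) * suc k)
                     (sym (i₄ r k))))

    fibCoeff₁-closed : ∀ k r → fibCoeff₁ (r + k) r ≐ sign k ⟨ fibCoeffNum (suc (2 * r)) k / fibCoeffDen (suc (2 * r)) k ⟩
    fibCoeff₁-closed zero    r =
      ≐-sub-vanishing (fibCoeff₀-vanish (s≤s (ℕP.≤-reflexive (ℕP.+-identityʳ r))))
        (≐-rescale (suc (2 * r) + 0 + 1) eD eN (fibCoeff₀-closed 0 r))
      where
      i : ∀ r → suc (2 * r) + 0 + 1 ≡ suc (2 * r + 0 + 1)
      i = solve-∀
      lD : ∀ a b → 1 * (a * b) ≡ 1 * b * a
      lD = solve-∀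
      eD : fibCoeffDen (suc (2 * r)) 0 ≡ fibCoeffDen (2 * r) 0 * (suc (2 * r) + 0 + 1)
      eD = trans (cong (1 *_) (!-suc (i r))) (lD (suc (2 * r) + 0 + 1) ((2 * r + 0 + 1) !))
      i′ : ∀ r → suc (2 * r) + 2 * 0 ≡ suc (2 * r + 2 * 0)
      i′ = solve-∀
      lN : ∀ r b → (suc (2 * r) + 2 * 0) * b * (suc (2 * r) + 1) ≡ b * (2 * r + 1) * (suc (2 * r) + 0 + 1)
      lN = solve-∀
      eN : fibCoeffNum (suc (2 * r)) 0 ≡ fibCoeffNum (2 * r) 0 * (suc (2 * r) + 0 + 1)
      eN = trans (cong (_* (suc (2 * r) + 1)) (!-suc (i′ r))) (lN r ((2 * r + 2 * 0) !))
    fibCoeff₁-closed (suc k) r =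
      ≐-combine (suc (2 * r) + suc k + 1) (suc k) eD₁ eD₂ eN
        (fibCoeff₀-closed (suc k) r)
        (≐-cong (cong (λ z → fibCoeff₀ z (suc r)) (sym (ℕP.+-suc r k))) (fibCoeff₀-closed k (suc r)))
      where
      i₁ : ∀ r k → suc (2 * r) + suc k + 1 ≡ suc (2 * r + suc k + 1)
      i₁ = solve-∀
      i₂ : ∀ r k → 2 * suc r + k + 1 ≡ suc (2 * r + suc k + 1)
      i₂ = solve-∀
      l₁ : ∀ f a α → f * (α * a) ≡ f * a * α
      l₁ = solve-∀
      eD₁ : fibCoeffDen (suc (2 * r)) (suc k) ≡ fibCoeffDen (2 * r) (suc k) * (suc (2 * r) + suc k + 1)
      eD₁ = trans (cong ((suc k) ! *_) (!-suc (i₁ r k))) (l₁ ((suc k) !) ((2 * r + suc k + 1) !) (suc (2 * r) + suc k + 1))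
      l₂ : ∀ r k f a → suc k * f * ((suc (2 * r) + suc k + 1) * a) ≡ f * ((2 * suc r + k + 1) * a) * suc k
      l₂ = solve-∀
      eD₂ : fibCoeffDen (suc (2 * r)) (suc k) ≡ fibCoeffDen (2 * suc r) k * suc k
      eD₂ = trans (cong ((suc k) ! *_) (!-suc (i₁ r k)))
              (trans (l₂ r k (k !) ((2 * r + suc k + 1) !)) (cong (λ z → k ! * z * suc k) (sym (!-suc (i₂ r k)))))
      i₃ : ∀ r k → suc (2 * r) + 2 * suc k ≡ suc (2 * r + 2 * suc k)
      i₃ = solve-∀
      i₄ : ∀ r k → 2 * suc r + 2 * k ≡ 2 * r + 2 * suc k
      i₄ = solve-∀
      l₃ : ∀ r k m → (suc (2 * r) + 2 * suc k) * m * (suc (2 * r) + 1)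
                     ≡ m * (2 * r + 1) * (suc (2 * r) + suc k + 1) + m * (2 * suc r + 1) * suc k
      l₃ = solve-∀
      eN : fibCoeffNum (suc (2 * r)) (suc k)
           ≡ fibCoeffNum (2 * r) (suc k) * (suc (2 * r) + suc k + 1) + fibCoeffNum (2 * suc r) k * suc k
      eN = trans (cong (_* (suc (2 * r) + 1)) (!-suc (i₃ r k)))
             (trans (l₃ r k ((2 * r + 2 * suc k) !))
               (cong (λ z → fibCoeffNum (2 * r) (suc k) * (suc (2 * r) + suc k + 1) + z ! * (2 * suc r + 1) * suc k)
                     (sym (i₄ r k))))

module ChebyshevCoefficients where
  open import Data.Nat using (_+_; _*_)
  open import Data.Nat.Tactic.RingSolver using (solve-∀)
  open ChebyshevExpansion
  open SignedRatios
  open Factorials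

  -- At N = i = 0 the denominator vanishes, so the closed form says nothing about chebCoeff₀ 0 0 = T_0.
  chebCoeffNum chebCoeffDen : ℕ → ℕ → ℕ
  chebCoeffNum N i = 2 ^ N * (N + 2 * i) * (N + i) !
  chebCoeffDen N i = i ! * N ! * 2 * (N + i)

  mutual
    chebCoeff₀-closed : ∀ i s → chebCoeff₀ (s + i) s ≐ sign i ⟨ chebCoeffNum (2 * s) i / chebCoeffDen (2 * s) i ⟩
    chebCoeff₀-closed zero          zero    = cross refl
    chebCoeff₀-closed (suc zero)    zero    = cross refl
    chebCoeff₀-closed (suc (suc i)) zero    =
      ≐-cancel (suc i) (λ ()) (≐-rescale (suc (suc i) * suc (suc i)) (lD i ((suc i) !)) (lN i ((suc i) !))
        (≐-neg (chebCoeff₀-closed (suc i) 0)))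
      where
      lD : ∀ i f → suc (suc i) * f * 1 * 2 * suc (suc i) * suc i ≡ f * 1 * 2 * suc i * (suc (suc i) * suc (suc i))
      lD = solve-∀
      lN : ∀ i f → 1 * (2 * suc (suc i)) * (suc (suc i) * f) * suc i ≡ 1 * (2 * suc i) * f * (suc (suc i) * suc (suc i))
      lN = solve-∀
    chebCoeff₀-closed zero          (suc s) =
      ≐-sub-vanishing (chebCoeff₀-vanish (s≤s (ℕP.≤-reflexive (ℕP.+-identityʳ s))))
        (≐-cancel (suc (2 * s)) (λ ()) (≐-rescale (suc (suc (2 * s)) * suc (suc (2 * s))) eD eN
          (≐-*ℕ 2 (chebCoeff₁-closed 0 s))))
      where
      lD : ∀ s f → 1 * ((2 * suc s) * f) * 2 * (2 * suc s + 0) * suc (2 * s)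
                   ≡ 1 * f * 2 * (suc (2 * s) + 0) * (suc (suc (2 * s)) * suc (suc (2 * s)))
      lD = solve-∀
      eD : chebCoeffDen (2 * suc s) 0 * suc (2 * s) ≡ chebCoeffDen (suc (2 * s)) 0 * (suc (suc (2 * s)) * suc (suc (2 * s)))
      eD = trans (cong (λ z → 1 * z * 2 * (2 * suc s + 0) * suc (2 * s)) (!-suc (ℕP.*-suc 2 s))) (lD s ((suc (2 * s)) !))
      i : ∀ s → 2 * suc s + 0 ≡ suc (suc (2 * s) + 0)
      i = solve-∀
      lN : ∀ s p f → 2 * (2 * p) * (2 * suc s + 2 * 0) * ((2 * suc s + 0) * f) * suc (2 * s)
                     ≡ 2 * (2 * p * (suc (2 * s) + 2 * 0) * f) * (suc (suc (2 * s)) * suc (suc (2 * s)))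
      lN = solve-∀
      eN : chebCoeffNum (2 * suc s) 0 * suc (2 * s) ≡ 2 * chebCoeffNum (suc (2 * s)) 0 * (suc (suc (2 * s)) * suc (suc (2 * s)))
      eN = trans (cong₂ (λ u v → u * (2 * suc s + 2 * 0) * v * suc (2 * s)) (cong (2 ^_) (ℕP.*-suc 2 s)) (!-suc (i s)))
             (lN s (2 ^ (2 * s)) ((suc (2 * s) + 0) !))
    chebCoeff₀-closed (suc i)       (suc s) =
      ≐-cancel (suc (suc (2 * s) + i)) (λ ())
        (≐-combine (suc (suc (2 * s)) * (2 * suc s + suc i)) (suc i * (2 * suc s + suc i)) eD₁ eD₂ eN
          (≐-*ℕ 2 (chebCoeff₁-closed (suc i) s))
          (≐-cong (cong (λ z → chebCoeff₀ z (suc s)) (sym (ℕP.+-suc s i))) (chebCoeff₀-closed i (suc s))))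
      where
      fx : (2 * suc s) ! ≡ (2 * suc s) * (suc (2 * s)) !
      fx = !-suc (ℕP.*-suc 2 s)
      l₁ : ∀ s i f₁ f₂ → (suc i * f₁) * ((2 * suc s) * f₂) * 2 * (2 * suc s + suc i) * suc (suc (2 * s) + i)
                         ≡ (suc i * f₁) * f₂ * 2 * (suc (2 * s) + suc i) * (suc (suc (2 * s)) * (2 * suc s + suc i))
      l₁ = solve-∀
      eD₁ : chebCoeffDen (2 * suc s) (suc i) * suc (suc (2 * s) + i)
            ≡ chebCoeffDen (suc (2 * s)) (suc i) * (suc (suc (2 * s)) * (2 * suc s + suc i))
      eD₁ = trans (cong (λ z → (suc i) ! * z * 2 * (2 * suc s + suc i) * suc (suc (2 * s) + i)) fx) (l₁ s i (i !) ((suc (2 * s)) !))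
      l₂ : ∀ s i f₁ f₂ → (suc i * f₁) * ((2 * suc s) * f₂) * 2 * (2 * suc s + suc i) * suc (suc (2 * s) + i)
                         ≡ f₁ * ((2 * suc s) * f₂) * 2 * (2 * suc s + i) * (suc i * (2 * suc s + suc i))
      l₂ = solve-∀
      eD₂ : chebCoeffDen (2 * suc s) (suc i) * suc (suc (2 * s) + i) ≡ chebCoeffDen (2 * suc s) i * (suc i * (2 * suc s + suc i))
      eD₂ = trans (cong (λ z → (suc i) ! * z * 2 * (2 * suc s + suc i) * suc (suc (2 * s) + i)) fx)
              (trans (l₂ s i (i !) ((suc (2 * s)) !)) (cong (λ z → i ! * z * 2 * (2 * suc s + i) * (suc i * (2 * suc s + suc i))) (sym fx)))
      i₁ : ∀ s i → 2 * suc s + suc i ≡ suc (suc (2 * s) + suc i)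
      i₁ = solve-∀
      i₂ : ∀ s i → 2 * suc s + i ≡ suc (2 * s) + suc i
      i₂ = solve-∀
      l₃ : ∀ s i p M → 2 * (2 * p) * (2 * suc s + 2 * suc i) * ((2 * suc s + suc i) * M) * suc (suc (2 * s) + i)
                       ≡ 2 * (2 * p * (suc (2 * s) + 2 * suc i) * M) * (suc (suc (2 * s)) * (2 * suc s + suc i))
                         + 2 * (2 * p) * (2 * suc s + 2 * i) * M * (suc i * (2 * suc s + suc i))
      l₃ = solve-∀
      eN : chebCoeffNum (2 * suc s) (suc i) * suc (suc (2 * s) + i)
           ≡ 2 * chebCoeffNum (suc (2 * s)) (suc i) * (suc (suc (2 * s)) * (2 * suc s + suc i))
             + chebCoeffNum (2 * suc s) i * (suc i * (2 * suc s + suc i))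
      eN = trans (cong₂ (λ u v → u * (2 * suc s + 2 * suc i) * v * suc (suc (2 * s) + i)) (cong (2 ^_) (ℕP.*-suc 2 s)) (!-suc (i₁ s i)))
             (trans (l₃ s i (2 ^ (2 * s)) ((suc (2 * s) + suc i) !))
               (cong₂ (λ u v → 2 * chebCoeffNum (suc (2 * s)) (suc i) * (suc (suc (2 * s)) * (2 * suc s + suc i))
                               + u * (2 * suc s + 2 * i) * v * (suc i * (2 * suc s + suc i)))
                      (cong (2 ^_) (sym (ℕP.*-suc 2 s))) (cong _! (sym (i₂ s i)))))

    chebCoeff₁-closed : ∀ i s → chebCoeff₁ (s + i) s ≐ sign i ⟨ chebCoeffNum (suc (2 * s)) i / chebCoeffDen (suc (2 * s)) i ⟩
    chebCoeff₁-closed zero    zero    = cross refl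
    chebCoeff₁-closed zero    (suc s) =
      ≐-sub-vanishing (chebCoeff₁-vanish (s≤s (ℕP.≤-reflexive (ℕP.+-identityʳ s))))
        (≐-cancel (suc (suc (2 * s))) (λ ()) (≐-rescale (suc (suc (suc (2 * s))) * suc (suc (suc (2 * s))))
          (lD s ((2 * suc s) !)) (lN s (2 ^ (2 * suc s)) ((2 * suc s + 0) !))
          (≐-*ℕ 2 (chebCoeff₀-closed 0 (suc s)))))
      where
      lD : ∀ s f → 1 * (suc (2 * suc s) * f) * 2 * (suc (2 * suc s) + 0) * suc (suc (2 * s))
                   ≡ 1 * f * 2 * (2 * suc s + 0) * (suc (suc (suc (2 * s))) * suc (suc (suc (2 * s))))
      lD = solve-∀
      lN : ∀ s q g → 2 * q * (suc (2 * suc s) + 2 * 0) * (suc (2 * suc s + 0) * g) * suc (suc (2 * s))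
                     ≡ 2 * (q * (2 * suc s + 2 * 0) * g) * (suc (suc (suc (2 * s))) * suc (suc (suc (2 * s))))
      lN = solve-∀
    chebCoeff₁-closed (suc i) s =
      subst (λ z → chebCoeff₁ z s ≐ sign (suc i) ⟨ chebCoeffNum (suc (2 * s)) (suc i) / chebCoeffDen (suc (2 * s)) (suc i) ⟩)
            (sym (ℕP.+-suc s i))
        (≐-cancel (suc (2 * s + i)) (λ ())
          (≐-combine (suc (2 * s) * (suc (2 * s) + suc i)) (suc i * (suc (2 * s) + suc i))
            (l₁ s i (i !) ((2 * s) !)) (l₂ s i (i !) ((2 * s) !)) eN
            (≐-*ℕ 2 (≐-cong (cong (λ z → chebCoeff₀ z s) (ℕP.+-suc s i)) (chebCoeff₀-closed (suc i) s)))
            (chebCoeff₁-closed i s)))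
      where
      l₁ : ∀ s i f₁ f₂ → (suc i * f₁) * (suc (2 * s) * f₂) * 2 * (suc (2 * s) + suc i) * suc (2 * s + i)
                         ≡ (suc i * f₁) * f₂ * 2 * (2 * s + suc i) * (suc (2 * s) * (suc (2 * s) + suc i))
      l₁ = solve-∀
      l₂ : ∀ s i f₁ f₂ → (suc i * f₁) * (suc (2 * s) * f₂) * 2 * (suc (2 * s) + suc i) * suc (2 * s + i)
                         ≡ f₁ * (suc (2 * s) * f₂) * 2 * (suc (2 * s) + i) * (suc i * (suc (2 * s) + suc i))
      l₂ = solve-∀
      l₃ : ∀ s i p M → 2 * p * (suc (2 * s) + 2 * suc i) * (suc (2 * s + suc i) * M) * suc (2 * s + i)
                       ≡ 2 * (p * (2 * s + 2 * suc i) * M) * (suc (2 * s) * (suc (2 * s) + suc i))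
                         + 2 * p * (suc (2 * s) + 2 * i) * M * (suc i * (suc (2 * s) + suc i))
      l₃ = solve-∀
      eN : chebCoeffNum (suc (2 * s)) (suc i) * suc (2 * s + i)
           ≡ 2 * chebCoeffNum (2 * s) (suc i) * (suc (2 * s) * (suc (2 * s) + suc i))
             + chebCoeffNum (suc (2 * s)) i * (suc i * (suc (2 * s) + suc i))
      eN = trans (l₃ s i (2 ^ (2 * s)) ((2 * s + suc i) !))
             (cong (λ v → 2 * chebCoeffNum (2 * s) (suc i) * (suc (2 * s) * (suc (2 * s) + suc i))
                          + 2 * 2 ^ (2 * s) * (suc (2 * s) + 2 * i) * v * (suc i * (suc (2 * s) + suc i)))
                   (cong _! (ℕP.+-suc (2 * s) i)))

module RisingFactorials where
  open import Data.Nat using (_+_; _*_)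
  open Factorials
  open import Data.Nat.Combinatorics using (_C_; nCk≡n!/k![n-k]!; k![n∸k]!∣n!)
  import Data.Nat.DivMod as ℕ÷
  open import Data.Nat.Divisibility using (_∣_)
  open import Data.Nat.Tactic.RingSolver using (solve-∀)

  rising : ℕ → ℕ → ℕ
  rising a zero    = 1
  rising a (suc k) = rising a k * (a + k)

  rising≢0 : ∀ {a} k → a ≢ 0 → rising a k ≢ 0
  rising≢0 zero    _   = λ ()
  rising≢0 (suc k) a≢0 = *-≢0 (rising≢0 k a≢0) (λ a+k≡0 → a≢0 (ℕP.m+n≡0⇒m≡0 _ a+k≡0))

  rising-suc-*-! : ∀ a k → rising (suc a) k * a ! ≡ (a + k) !
  rising-suc-*-! a zero    = trans (ℕP.+-identityʳ (a !)) (cong _! (sym (ℕP.+-identityʳ a)))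
  rising-suc-*-! a (suc k) = begin
      rising (suc a) k * (suc a + k) * a ! ≡⟨ l (rising (suc a) k) (suc a + k) (a !) ⟩
      (suc a + k) * (rising (suc a) k * a !) ≡⟨ cong ((suc a + k) *_) (rising-suc-*-! a k) ⟩
      (suc (a + k)) !                        ≡⟨ cong _! (ℕP.+-suc a k) ⟨
      (a + suc k) !                          ∎
    where
    open ≡-Reasoning
    l : ∀ x y z → x * y * z ≡ y * (x * z)
    l = solve-∀

  -- (a)_k = (a + k - 1)! / (a - 1)!, stated without subtraction.
  rising-*-! : ∀ a k → rising a k * a ! * (a + k) ≡ (a + k) ! * a
  rising-*-! a zero    = trans (l a (a !)) (cong (λ z → z ! * a) (sym (ℕP.+-identityʳ a)))
    where
    l : ∀ a f → 1 * f * (a + 0) ≡ f * a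
    l = solve-∀
  rising-*-! a (suc k) = begin
      rising a k * (a + k) * a ! * (a + suc k)  ≡⟨ l₁ (rising a k) (a + k) (a !) (a + suc k) ⟩
      rising a k * a ! * (a + k) * (a + suc k)  ≡⟨ cong (_* (a + suc k)) (rising-*-! a k) ⟩
      (a + k) ! * a * (a + suc k)               ≡⟨ cong (λ z → (a + k) ! * a * z) (ℕP.+-suc a k) ⟩
      (a + k) ! * a * suc (a + k)               ≡⟨ l₂ ((a + k) !) a (suc (a + k)) ⟩
      (suc (a + k)) ! * a                       ≡⟨ cong (λ z → z ! * a) (ℕP.+-suc a k) ⟨
      (a + suc k) ! * a                         ∎
    where
    open ≡-Reasoning
    l₁ : ∀ x y z w → x * y * z * w ≡ x * z * y * w
    l₁ = solve-∀
    l₂ : ∀ x y z → x * y * z ≡ z * x * y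
    l₂ = solve-∀

  C-*-!-! : ∀ n m → ((n + m) C n) * (n ! * m !) ≡ (n + m) !
  C-*-!-! n m = begin
      ((n + m) C n) * (n ! * m !)
        ≡⟨ cong (_* (n ! * m !)) (nCk≡n!/k![n-k]! (ℕP.m≤m+n n m)) ⟩
      ((n + m) ! ℕ÷./ (n ! * ((n + m) ∸ n) !)) {{ℕP._!*_!≢0 n ((n + m) ∸ n)}} * (n ! * m !)
        ≡⟨ cong (λ z → ((n + m) ! ℕ÷./ (n ! * z !)) {{ℕP._!*_!≢0 n z}} * (n ! * m !)) m+n∸m≡n ⟩
      ((n + m) ! ℕ÷./ (n ! * m !)) {{ℕP._!*_!≢0 n m}} * (n ! * m !)
        ≡⟨ ℕ÷.m/n*n≡m {{ℕP._!*_!≢0 n m}} (subst (λ z → n ! * z ! ∣ (n + m) !) m+n∸m≡n (k![n∸k]!∣n! (ℕP.m≤m+n n m))) ⟩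
      (n + m) ! ∎
    where
    open ≡-Reasoning
    m+n∸m≡n : (n + m) ∸ n ≡ m
    m+n∸m≡n = ℕP.m+n∸m≡n n m

module CoefficientMatching where
  open import Data.Nat using (_+_; _*_)
  open import Data.Nat.Tactic.RingSolver using (solve-∀)
  open Factorials
  open RisingFactorials
  open FibonacciCoefficients using (fibCoeffNum; fibCoeffDen)
  open ChebyshevCoefficients using (chebCoeffNum; chebCoeffDen)

  module _ (n k i : ℕ) where
    private
      m = k + i
      a = n + m

    -- Numerator and denominator of (n + 2m) · prefactor n m · hypTerm n m k, factor by factor.
    termNum termDen : ℕ
    termNum = (n + 2 * m) * (a ! * 2 ^ n) * ((m ! * rising a k) * 4 ^ k)
    termDen = ((n ! * m !) * (a * 2)) * (((rising (n + 2) k * k !) * (i ! * 1)) * 1)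

    termDen≢0 : a ≢ 0 → termDen ≢ 0
    termDen≢0 a≢0 = *-≢0 (*-≢0 (*-≢0 (!≢0 n) (!≢0 m)) (*-≢0 a≢0 (λ ())))
                         (*-≢0 (*-≢0 (*-≢0 (rising≢0 k (ℕP.m+1+n≢0 n)) (!≢0 k)) (*-≢0 (!≢0 i) (λ ()))) (λ ()))

    coeffProductDen≢0 : a ≢ 0 → chebCoeffDen (n + 2 * k) i * fibCoeffDen n k ≢ 0
    coeffProductDen≢0 a≢0 = *-≢0 (*-≢0 (*-≢0 (*-≢0 (!≢0 i) (!≢0 (n + 2 * k))) (λ ())) N+i≢0) (*-≢0 (!≢0 k) (!≢0 (n + k + 1)))
      where
      N+i≢0 : (n + 2 * k) + i ≢ 0
      N+i≢0 e = a≢0 (ℕP.m+n≡0⇒m≡0 a (trans (rearrange n k i) e))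
        where
        rearrange : ∀ n k i → (n + (k + i)) + k ≡ (n + 2 * k) + i
        rearrange = solve-∀

    term-cross : termNum * (chebCoeffDen (n + 2 * k) i * fibCoeffDen n k)
               ≡ (chebCoeffNum (n + 2 * k) i * fibCoeffNum n k) * termDen
    term-cross = begin
        termNum * (chebCoeffDen (n + 2 * k) i * fibCoeffDen n k)
          ≡⟨ l₁ n k i (a !) (m !) (i !) ((n + 2 * k) !) (k !) ((n + k + 1) !) (2 ^ n) (4 ^ k) (rising a k) ⟩
        W₁ * (rising a k * a ! * (a + k))
          ≡⟨ cong (W₁ *_) (rising-*-! a k) ⟩
        W₁ * ((a + k) ! * a)
          ≡⟨ l₂ n k i ((a + k) !) (m !) (i !) ((n + 2 * k) !) (k !) ((n + k + 1) !) (2 ^ n) (4 ^ k) ⟩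
        W₂ * (n + k + 1) !
          ≡⟨ cong (W₂ *_) (sym lowerRising) ⟩
        W₂ * (rising (n + 2) k * ((n + 1) * n !))
          ≡⟨ sym (l₃ n k i ((a + k) !) (n !) (m !) (i !) ((n + 2 * k) !) (k !) (2 ^ n) (4 ^ k) (rising (n + 2) k)) ⟩
        ((2 ^ n * 4 ^ k) * ((n + 2 * k) + 2 * i) * (a + k) !) * ((n + 2 * k) ! * (n + 1)) * termDen
          ≡⟨ cong₂ (λ u w → (u * ((n + 2 * k) + 2 * i) * w) * ((n + 2 * k) ! * (n + 1)) * termDen)
                   (sym 2^[n+2k]) (cong _! (rearrange n k i)) ⟩
        (chebCoeffNum (n + 2 * k) i * fibCoeffNum n k) * termDen ∎
      where
      open ≡-Reasoning
      W₁ = (n + 2 * m) * 2 ^ n * m ! * 4 ^ k * i ! * (n + 2 * k) ! * 2 * k ! * (n + k + 1) !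
      W₂ = 2 ^ n * 4 ^ k * ((n + 2 * k) + 2 * i) * (a + k) ! * (n + 2 * k) ! * m ! * a * 2 * k ! * i !
      rearrange : ∀ n k i → (n + (k + i)) + k ≡ (n + 2 * k) + i
      rearrange = solve-∀
      2^[n+2k] : 2 ^ (n + 2 * k) ≡ 2 ^ n * 4 ^ k
      2^[n+2k] = trans (ℕP.^-distribˡ-+-* 2 n (2 * k)) (cong (2 ^ n *_) (sym (ℕP.^-*-assoc 2 2 k)))
      lowerRising : rising (n + 2) k * ((n + 1) * n !) ≡ (n + k + 1) !
      lowerRising = begin
          rising (n + 2) k * ((n + 1) * n !) ≡⟨ cong₂ _*_ (cong (λ z → rising z k) (ℕP.+-suc n 1)) (sym (!-suc (ℕP.+-comm n 1))) ⟩
          rising (suc (n + 1)) k * (n + 1) ! ≡⟨ rising-suc-*-! (n + 1) k ⟩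
          ((n + 1) + k) !                     ≡⟨ cong _! (l n k) ⟩
          (n + k + 1) !                       ∎
        where
        l : ∀ n k → (n + 1) + k ≡ n + k + 1
        l = solve-∀
      l₁ : ∀ n k i A Fm Fi F2k Fk Fk1 P2 P4 R →
           (n + 2 * (k + i)) * (A * P2) * ((Fm * R) * P4) * ((Fi * F2k * 2 * ((n + 2 * k) + i)) * (Fk * Fk1))
           ≡ ((n + 2 * (k + i)) * P2 * Fm * P4 * Fi * F2k * 2 * Fk * Fk1) * (R * A * ((n + (k + i)) + k))
      l₁ = solve-∀
      l₂ : ∀ n k i B Fm Fi F2k Fk Fk1 P2 P4 →
           ((n + 2 * (k + i)) * P2 * Fm * P4 * Fi * F2k * 2 * Fk * Fk1) * (B * (n + (k + i)))
           ≡ (P2 * P4 * ((n + 2 * k) + 2 * i) * B * F2k * Fm * (n + (k + i)) * 2 * Fk * Fi) * Fk1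
      l₂ = solve-∀
      l₃ : ∀ n k i B Fn Fm Fi F2k Fk P2 P4 R →
           ((P2 * P4) * ((n + 2 * k) + 2 * i) * B) * (F2k * (n + 1))
             * (((Fn * Fm) * ((n + (k + i)) * 2)) * (((R * Fk) * (Fi * 1)) * 1))
           ≡ (P2 * P4 * ((n + 2 * k) + 2 * i) * B * F2k * Fm * (n + (k + i)) * 2 * Fk * Fi) * (R * ((n + 1) * Fn))
      l₃ = solve-∀

module HypergeometricTerms where
  open import Data.Rational using (_+_; _*_; -_)
  open import Data.Nat.Combinatorics using (_C_)
  open +-*-Solver
  open RationalArithmetic
  open SignedRatios
  open Factorials
  open RisingFactorials
  open FibonacciCoefficients using (fibCoeffNum; fibCoeffDen)
  open ChebyshevCoefficients using (chebCoeffNum; chebCoeffDen)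
  open CoefficientMatching

  sign-+ : ∀ k i → sign (k ℕ.+ i) ≡ sign k * sign i
  sign-+ zero    i = sym (ℚP.*-identityˡ (sign i))
  sign-+ (suc k) i = trans (cong ((- 1ℚ) *_) (sign-+ k i)) (sym (ℚP.*-assoc (- 1ℚ) (sign k) (sign i)))

  sign-*-sign : ∀ k → sign k * sign k ≡ 1ℚ
  sign-*-sign zero    = refl
  sign-*-sign (suc k) = trans (solve 1 (λ s → (con (- 1ℚ) :* s) :* (con (- 1ℚ) :* s) := s :* s) refl (sign k)) (sign-*-sign k)

  neg-^ℚ : ∀ a k → (- ℕ→ℚ a) ^ℚ k ≐ sign k ⟨ a ^ k / 1 ⟩
  neg-^ℚ a zero    = cross refl
  neg-^ℚ a (suc k) with neg-^ℚ a k
  ... | cross h = cross (begin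
      ((- ℕ→ℚ a) * P) * 1ℚ                 ≡⟨ ℚP.*-identityʳ _ ⟩
      (- ℕ→ℚ a) * P                        ≡⟨ cong ((- ℕ→ℚ a) *_) (trans (sym (ℚP.*-identityʳ P)) h) ⟩
      (- ℕ→ℚ a) * (sign k * ℕ→ℚ (a ^ k))  ≡⟨ solve 3 (λ a s p → (:- a) :* (s :* p) := (con (- 1ℚ) :* s) :* (a :* p)) refl
                                                 (ℕ→ℚ a) (sign k) (ℕ→ℚ (a ^ k)) ⟩
      sign (suc k) * (ℕ→ℚ a * ℕ→ℚ (a ^ k)) ≡⟨ cong (sign (suc k) *_) (ℕ→ℚ-* a (a ^ k)) ⟨
      sign (suc k) * ℕ→ℚ (a ^ suc k)       ∎)
    where
    open ≡-Reasoning
    P = (- ℕ→ℚ a) ^ℚ k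

  poch-ℕ→ℚ : ∀ a k → poch (ℕ→ℚ a) k ≡ ℕ→ℚ (rising a k)
  poch-ℕ→ℚ a zero    = refl
  poch-ℕ→ℚ a (suc k) = begin
      poch (ℕ→ℚ a) k * (ℕ→ℚ a + ℕ→ℚ k)   ≡⟨ cong₂ _*_ (poch-ℕ→ℚ a k) (sym (ℕ→ℚ-+ a k)) ⟩
      ℕ→ℚ (rising a k) * ℕ→ℚ (a ℕ.+ k)   ≡⟨ ℕ→ℚ-* (rising a k) (a ℕ.+ k) ⟨
      ℕ→ℚ (rising a k ℕ.* (a ℕ.+ k))     ∎
    where open ≡-Reasoning

  poch-neg : ∀ k i → poch (- ℕ→ℚ (k ℕ.+ i)) k ≐ sign k ⟨ (k ℕ.+ i) ! / i ! ⟩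
  poch-neg zero    i = cross refl
  poch-neg (suc k) i with poch-neg k (suc i)
  ... | cross h = cross (begin
      poch A k * (A + ℕ→ℚ k) * ℕ→ℚ (i !)
        ≡⟨ cong (λ z → poch z k * (z + ℕ→ℚ k) * ℕ→ℚ (i !)) A≡A′ ⟩
      poch A′ k * (A′ + ℕ→ℚ k) * ℕ→ℚ (i !)
        ≡⟨ cong (λ z → poch A′ k * z * ℕ→ℚ (i !)) last-factor ⟩
      poch A′ k * (- ℕ→ℚ (suc i)) * ℕ→ℚ (i !)
        ≡⟨ solve 3 (λ p a f → p :* (:- a) :* f := con (- 1ℚ) :* (p :* (a :* f))) refl (poch A′ k) (ℕ→ℚ (suc i)) (ℕ→ℚ (i !)) ⟩
      (- 1ℚ) * (poch A′ k * (ℕ→ℚ (suc i) * ℕ→ℚ (i !)))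
        ≡⟨ cong (λ z → (- 1ℚ) * (poch A′ k * z)) (sym (ℕ→ℚ-* (suc i) (i !))) ⟩
      (- 1ℚ) * (poch A′ k * ℕ→ℚ ((suc i) !))
        ≡⟨ cong ((- 1ℚ) *_) h ⟩
      (- 1ℚ) * (sign k * ℕ→ℚ ((k ℕ.+ suc i) !))
        ≡⟨ cong (λ z → (- 1ℚ) * (sign k * ℕ→ℚ (z !))) (ℕP.+-suc k i) ⟩
      (- 1ℚ) * (sign k * ℕ→ℚ ((suc k ℕ.+ i) !))
        ≡⟨ ℚP.*-assoc (- 1ℚ) (sign k) _ ⟨
      sign (suc k) * ℕ→ℚ ((suc k ℕ.+ i) !) ∎)
    where
    open ≡-Reasoning
    A  = - ℕ→ℚ (suc k ℕ.+ i)
    A′ = - ℕ→ℚ (k ℕ.+ suc i)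
    A≡A′ : A ≡ A′
    A≡A′ = cong (λ z → - ℕ→ℚ z) (sym (ℕP.+-suc k i))
    last-factor : A′ + ℕ→ℚ k ≡ - ℕ→ℚ (suc i)
    last-factor = begin
      - ℕ→ℚ (k ℕ.+ suc i) + ℕ→ℚ k     ≡⟨ cong (λ z → - z + ℕ→ℚ k) (ℕ→ℚ-+ k (suc i)) ⟩
      - (ℕ→ℚ k + ℕ→ℚ (suc i)) + ℕ→ℚ k ≡⟨ solve 2 (λ a b → :- (a :+ b) :+ a := :- b) refl (ℕ→ℚ k) (ℕ→ℚ (suc i)) ⟩
      - ℕ→ℚ (suc i)                     ∎

  prefactor : ℕ → ℕ → ℚ
  prefactor n m = (sign m * ℕ→ℚ ((n ℕ.+ m) C n)) * (((ℕ→ℚ 2 ^ℚ n) ÷₀ ℕ→ℚ 2) ÷₀ ℕ→ℚ (n ℕ.+ m))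

  hypTerm : ℕ → ℕ → ℕ → ℚ
  hypTerm n m k = ((poch (- ℕ→ℚ m) k * poch (ℕ→ℚ (n ℕ.+ m)) k) ÷₀ (poch (ℕ→ℚ (n ℕ.+ 2)) k * ℕ→ℚ (k !)))
                  * ((- ℕ→ℚ 4) ^ℚ k)

  module _ (n k i : ℕ) where
    private
      m = k ℕ.+ i
      a = n ℕ.+ m

    term-≐ : a ≢ 0 → (ℕ→ℚ (n ℕ.+ 2 ℕ.* m) * prefactor n m) * hypTerm n m k
                     ≐ ((sign m * 1ℚ) * 1ℚ) * ((sign k * 1ℚ) * sign k) ⟨ termNum n k i / termDen n k i ⟩
    term-≐ a≢0 = ≐-* (≐-*ℕ (n ℕ.+ 2 ℕ.* m) (≐-* (≐-*ˡ (sign m) binomial) power)) (≐-* quotient (neg-^ℚ 4 k))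
      where
      binomial : ℕ→ℚ ((n ℕ.+ m) C n) ≐ 1ℚ ⟨ a ! / n ! ℕ.* m ! ⟩
      binomial = cross (trans (sym (ℕ→ℚ-* ((n ℕ.+ m) C n) (n ! ℕ.* m !)))
                       (trans (cong ℕ→ℚ (C-*-!-! n m)) (sym (ℚP.*-identityˡ _))))
      power : ((ℕ→ℚ 2 ^ℚ n) ÷₀ ℕ→ℚ 2) ÷₀ ℕ→ℚ a ≐ 1ℚ ⟨ 2 ^ n / a ℕ.* 2 ⟩
      power = ≐-÷₀ a a≢0 (≐-÷₀ 2 (λ ()) (≐-cong (sym (ℕ→ℚ-^ 2 n)) (ℕ→ℚ-≐ (2 ^ n))))
      denominator : poch (ℕ→ℚ (n ℕ.+ 2)) k * ℕ→ℚ (k !) ≡ ℕ→ℚ (rising (n ℕ.+ 2) k ℕ.* k !)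
      denominator = trans (cong (_* ℕ→ℚ (k !)) (poch-ℕ→ℚ (n ℕ.+ 2) k)) (sym (ℕ→ℚ-* (rising (n ℕ.+ 2) k) (k !)))
      quotient : (poch (- ℕ→ℚ m) k * poch (ℕ→ℚ a) k) ÷₀ (poch (ℕ→ℚ (n ℕ.+ 2)) k * ℕ→ℚ (k !))
                 ≐ sign k * 1ℚ ⟨ m ! ℕ.* rising a k / (rising (n ℕ.+ 2) k ℕ.* k !) ℕ.* (i ! ℕ.* 1) ⟩
      quotient = ≐-cong (cong (λ q → (poch (- ℕ→ℚ m) k * poch (ℕ→ℚ a) k) ÷₀ q) (sym denominator))
                   (≐-÷₀ (rising (n ℕ.+ 2) k ℕ.* k !) (*-≢0 (rising≢0 k (ℕP.m+1+n≢0 n)) (!≢0 k))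
                     (≐-* (poch-neg k i) (≐-cong (sym (poch-ℕ→ℚ a k)) (ℕ→ℚ-≐ (rising a k)))))

    hypTerm-factorises : ∀ {c b} → a ≢ 0 →
      c ≐ sign i ⟨ chebCoeffNum (n ℕ.+ 2 ℕ.* k) i / chebCoeffDen (n ℕ.+ 2 ℕ.* k) i ⟩ →
      b ≐ sign k ⟨ fibCoeffNum n k / fibCoeffDen n k ⟩ →
      (ℕ→ℚ (n ℕ.+ 2 ℕ.* m) * prefactor n m) * hypTerm n m k ≡ c * b
    hypTerm-factorises a≢0 hc hb =
      ≐-unique (termDen≢0 n k i a≢0) (coeffProductDen≢0 n k i a≢0) (term-cross n k i)
        (subst (λ σ → (ℕ→ℚ (n ℕ.+ 2 ℕ.* m) * prefactor n m) * hypTerm n m k ≐ σ ⟨ termNum n k i / termDen n k i ⟩)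
               signs (term-≐ a≢0))
        (≐-* hc hb)
      where
      signs : ((sign m * 1ℚ) * 1ℚ) * ((sign k * 1ℚ) * sign k) ≡ sign i * sign k
      signs = begin
          ((sign m * 1ℚ) * 1ℚ) * ((sign k * 1ℚ) * sign k)
            ≡⟨ cong (λ z → ((z * 1ℚ) * 1ℚ) * ((sign k * 1ℚ) * sign k)) (sign-+ k i) ⟩
          ((sign k * sign i * 1ℚ) * 1ℚ) * ((sign k * 1ℚ) * sign k)
            ≡⟨ solve 2 (λ s t → ((s :* t :* con 1ℚ) :* con 1ℚ) :* ((s :* con 1ℚ) :* s) := (t :* s) :* (s :* s)) refl (sign k) (sign i) ⟩
          (sign i * sign k) * (sign k * sign k)
            ≡⟨ cong ((sign i * sign k) *_) (sign-*-sign k) ⟩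
          (sign i * sign k) * 1ℚ
            ≡⟨ ℚP.*-identityʳ _ ⟩
          sign i * sign k ∎
        where open ≡-Reasoning

module Assembly where
  open import Data.Rational using (_*_; -_)
  open import Data.Nat.Combinatorics using (_C_)
  open import Data.Nat.Tactic.RingSolver using (solve-∀)
  open +-*-Solver
  open FiniteSums
  open FibonacciExpansion
  open ChebyshevExpansion
  open SignedRatios
  open FibonacciCoefficients
  open ChebyshevCoefficients
  open HypergeometricTerms

  record ParityExpansions (p : ℕ) : Set where
    field
      chebCoeff fibCoeff : ℕ → ℕ → ℚ
      cheb-expansion : ∀ x h → cheb (p ℕ.+ 2 ℕ.* h) x ≡ sumTo h (λ s → chebCoeff h s * x ^ℚ (p ℕ.+ 2 ℕ.* s))
      pow-expansion  : ∀ x s → x ^ℚ (p ℕ.+ 2 ℕ.* s) ≡ sumTo s (λ r → fibCoeff s r * fibPoly (suc (p ℕ.+ 2 ℕ.* r)) x)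
      chebCoeff-closed : ∀ i s → chebCoeff (s ℕ.+ i) s
                                   ≐ sign i ⟨ chebCoeffNum (p ℕ.+ 2 ℕ.* s) i / chebCoeffDen (p ℕ.+ 2 ℕ.* s) i ⟩
      fibCoeff-closed  : ∀ k r → fibCoeff (r ℕ.+ k) r
                                   ≐ sign k ⟨ fibCoeffNum (p ℕ.+ 2 ℕ.* r) k / fibCoeffDen (p ℕ.+ 2 ℕ.* r) k ⟩

  even : ParityExpansions 0
  even = record
    { chebCoeff        = chebCoeff₀
    ; fibCoeff         = fibCoeff₀
    ; cheb-expansion   = cheb-powExpansion₀
    ; pow-expansion    = ^-fibExpansion₀
    ; chebCoeff-closed = chebCoeff₀-closed
    ; fibCoeff-closed  = fibCoeff₀-closed
    }

  odd : ParityExpansions 1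
  odd = record
    { chebCoeff        = chebCoeff₁
    ; fibCoeff         = fibCoeff₁
    ; cheb-expansion   = cheb-powExpansion₁
    ; pow-expansion    = ^-fibExpansion₁
    ; chebCoeff-closed = chebCoeff₁-closed
    ; fibCoeff-closed  = fibCoeff₁-closed
    }

  module _ (x : ℚ) where
    private
      F : ℕ → ℚ
      F n = fibPoly n x

    summand-unfold : ∀ n m → summand (n ℕ.+ 2 ℕ.* m) x m ≡ (prefactor n m * sumTo m (hypTerm n m)) * F (n ℕ.+ 1)
    summand-unfold n m = cong₂ (λ a b → ((sign m * ℕ→ℚ (a C b)) * (((ℕ→ℚ 2 ^ℚ b) ÷₀ ℕ→ℚ 2) ÷₀ ℕ→ℚ a)
                                         * hyp2F1 m (ℕ→ℚ a) (ℕ→ℚ (b ℕ.+ 2)) (- ℕ→ℚ 4)) * F (b ℕ.+ 1))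
                               j∸m j∸2m
      where
      j∸m : n ℕ.+ 2 ℕ.* m ∸ m ≡ n ℕ.+ m
      j∸m = trans (cong (_∸ m) (l n m)) (ℕP.m+n∸n≡m (n ℕ.+ m) m)
        where
        l : ∀ n m → n ℕ.+ 2 ℕ.* m ≡ (n ℕ.+ m) ℕ.+ m
        l = solve-∀
      j∸2m : n ℕ.+ 2 ℕ.* m ∸ 2 ℕ.* m ≡ n
      j∸2m = ℕP.m+n∸n≡m n (2 ℕ.* m)

    summand-as-sum : ∀ n m {c b : ℕ → ℚ} → n ℕ.+ m ≢ 0 →
      (∀ k → k ≤ m → c k ≐ sign (m ∸ k) ⟨ chebCoeffNum (n ℕ.+ 2 ℕ.* k) (m ∸ k) / chebCoeffDen (n ℕ.+ 2 ℕ.* k) (m ∸ k) ⟩) →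
      (∀ k → k ≤ m → b k ≐ sign k ⟨ fibCoeffNum n k / fibCoeffDen n k ⟩) →
      ℕ→ℚ (n ℕ.+ 2 ℕ.* m) * summand (n ℕ.+ 2 ℕ.* m) x m ≡ sumTo m (λ k → (c k * b k) * F (n ℕ.+ 1))
    summand-as-sum n m {c} {b} n+m≢0 hc hb = begin
        jℚ * summand (n ℕ.+ 2 ℕ.* m) x m              ≡⟨ cong (jℚ *_) (summand-unfold n m) ⟩
        jℚ * ((prefactor n m * sumTo m (hypTerm n m)) * F (n ℕ.+ 1))
          ≡⟨ solve 4 (λ j a s f → j :* ((a :* s) :* f) := ((j :* a) :* s) :* f) refl
                     jℚ (prefactor n m) (sumTo m (hypTerm n m)) (F (n ℕ.+ 1)) ⟩
        ((jℚ * prefactor n m) * sumTo m (hypTerm n m)) * F (n ℕ.+ 1)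
          ≡⟨ cong (_* F (n ℕ.+ 1)) (sumTo-*ˡ m (jℚ * prefactor n m) (hypTerm n m)) ⟩
        sumTo m (λ k → (jℚ * prefactor n m) * hypTerm n m k) * F (n ℕ.+ 1)
          ≡⟨ sumTo-*ʳ m (F (n ℕ.+ 1)) _ ⟩
        sumTo m (λ k → ((jℚ * prefactor n m) * hypTerm n m k) * F (n ℕ.+ 1))
          ≡⟨ sumTo-cong m (λ k k≤m → cong (_* F (n ℕ.+ 1)) (term k k≤m)) ⟩
        sumTo m (λ k → (c k * b k) * F (n ℕ.+ 1)) ∎
      where
      open ≡-Reasoning
      jℚ = ℕ→ℚ (n ℕ.+ 2 ℕ.* m)
      term : ∀ k → k ≤ m → (jℚ * prefactor n m) * hypTerm n m k ≡ c k * b k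
      term k k≤m = subst (λ M → (ℕ→ℚ (n ℕ.+ 2 ℕ.* M) * prefactor n M) * hypTerm n M k ≡ c k * b k) k+[m∸k]≡m
                         (hypTerm-factorises n k (m ∸ k) (subst (λ M → n ℕ.+ M ≢ 0) (sym k+[m∸k]≡m) n+m≢0)
                                             (hc k k≤m) (hb k k≤m))
        where
        k+[m∸k]≡m : k ℕ.+ (m ∸ k) ≡ m
        k+[m∸k]≡m = ℕP.m+[n∸m]≡n k≤m

    cheb-as-summands : ∀ {p} → ParityExpansions p → ∀ h → p ℕ.+ 2 ℕ.* h ≢ 0 →
      cheb (p ℕ.+ 2 ℕ.* h) x ≡ ℕ→ℚ (p ℕ.+ 2 ℕ.* h) * sumTo h (summand (p ℕ.+ 2 ℕ.* h) x)
    cheb-as-summands {p} E h j≢0 = begin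
        cheb j x                                              ≡⟨ cheb-expansion x h ⟩
        sumTo h (λ s → chebCoeff h s * x ^ℚ (p ℕ.+ 2 ℕ.* s))   ≡⟨ sumTo-cong h (λ s _ → expand s) ⟩
        sumTo h (λ s → sumTo s (g s))                          ≡⟨ sumTo-triangle h g ⟩
        sumTo h (λ m → sumTo m (λ k → g ((h ∸ m) ℕ.+ k) (h ∸ m)))
          ≡⟨ sumTo-cong h (λ m m≤h → sym (column m m≤h)) ⟩
        sumTo h (λ m → ℕ→ℚ j * summand j x m)                  ≡⟨ sumTo-*ˡ h (ℕ→ℚ j) (summand j x) ⟨
        ℕ→ℚ j * sumTo h (summand j x)                          ∎
      where
      open ≡-Reasoning
      open ParityExpansions E
      j = p ℕ.+ 2 ℕ.* h
      g : ℕ → ℕ → ℚ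
      g s r = (chebCoeff h s * fibCoeff s r) * F (suc (p ℕ.+ 2 ℕ.* r))
      expand : ∀ s → chebCoeff h s * x ^ℚ (p ℕ.+ 2 ℕ.* s) ≡ sumTo s (g s)
      expand s = trans (cong (chebCoeff h s *_) (pow-expansion x s))
                   (trans (sumTo-*ˡ s (chebCoeff h s) _)
                          (sumTo-cong s (λ r _ → sym (ℚP.*-assoc (chebCoeff h s) (fibCoeff s r) _))))
      column : ∀ m → m ≤ h → ℕ→ℚ j * summand j x m ≡ sumTo m (λ k → g ((h ∸ m) ℕ.+ k) (h ∸ m))
      column m m≤h =
        subst (λ J′ → ℕ→ℚ J′ * summand J′ x m ≡ sumTo m (λ k → g (r ℕ.+ k) r)) (sym j≡n+2m)
          (trans (summand-as-sum n m n+m≢0 hc (λ k _ → fibCoeff-closed k r))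
                 (sumTo-cong m (λ k _ → cong (λ t → (chebCoeff h (r ℕ.+ k) * fibCoeff (r ℕ.+ k) r) * F t) (ℕP.+-comm n 1))))
        where
        r = h ∸ m
        n = p ℕ.+ 2 ℕ.* r
        j≡n+2m : j ≡ n ℕ.+ 2 ℕ.* m
        j≡n+2m = trans (cong (λ H → p ℕ.+ 2 ℕ.* H) (sym (ℕP.m∸n+n≡m m≤h))) (l p r m)
          where
          l : ∀ p r m → p ℕ.+ 2 ℕ.* (r ℕ.+ m) ≡ (p ℕ.+ 2 ℕ.* r) ℕ.+ 2 ℕ.* m
          l = solve-∀
        n+m≢0 : n ℕ.+ m ≢ 0
        n+m≢0 e = j≢0 (trans j≡n+2m (cong₂ (λ a b → a ℕ.+ 2 ℕ.* b) (ℕP.m+n≡0⇒m≡0 n e) (ℕP.m+n≡0⇒n≡0 n e)))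
        hc : ∀ k → k ≤ m → chebCoeff h (r ℕ.+ k)
                             ≐ sign (m ∸ k) ⟨ chebCoeffNum (n ℕ.+ 2 ℕ.* k) (m ∸ k) / chebCoeffDen (n ℕ.+ 2 ℕ.* k) (m ∸ k) ⟩
        hc k k≤m = subst₂ (λ H N → chebCoeff H (r ℕ.+ k) ≐ sign (m ∸ k) ⟨ chebCoeffNum N (m ∸ k) / chebCoeffDen N (m ∸ k) ⟩)
                          [r+k]+[m∸k]≡h (l p r k) (chebCoeff-closed (m ∸ k) (r ℕ.+ k))
          where
          [r+k]+[m∸k]≡h : (r ℕ.+ k) ℕ.+ (m ∸ k) ≡ h
          [r+k]+[m∸k]≡h = trans (ℕP.+-assoc r k (m ∸ k)) (trans (cong (r ℕ.+_) (ℕP.m+[n∸m]≡n k≤m)) (ℕP.m∸n+n≡m m≤h))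
          l : ∀ p r k → p ℕ.+ 2 ℕ.* (r ℕ.+ k) ≡ (p ℕ.+ 2 ℕ.* r) ℕ.+ 2 ℕ.* k
          l = solve-∀

  ⌊/2⌋-parity : ∀ j → j ≡ 0 ℕ.+ 2 ℕ.* ℕ.⌊ j /2⌋ ⊎ j ≡ 1 ℕ.+ 2 ℕ.* ℕ.⌊ j /2⌋
  ⌊/2⌋-parity zero          = inj₁ refl
  ⌊/2⌋-parity (suc zero)    = inj₂ refl
  ⌊/2⌋-parity (suc (suc j)) with ⌊/2⌋-parity j
  ... | inj₁ j≡2h   = inj₁ (trans (cong (λ z → suc (suc z)) j≡2h) (sym (ℕP.*-suc 2 ℕ.⌊ j /2⌋)))
  ... | inj₂ j≡2h+1 = inj₂ (trans (cong (λ z → suc (suc z)) j≡2h+1) (cong suc (sym (ℕP.*-suc 2 ℕ.⌊ j /2⌋))))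

open Assembly using (⌊/2⌋-parity; cheb-as-summands; even; odd)
open import Data.Nat using (_≥_; ⌊_/2⌋)
open import Data.Rational using (_*_)

theorem1 : (j : ℕ) → j ≥ 1 → (x : ℚ) →
    cheb j x ≡ ℕ→ℚ j * sumTo ⌊ j /2⌋ (summand j x)
theorem1 j j≥1 x with ⌊/2⌋-parity j
... | inj₁ j≡2h   = subst (λ J′ → cheb J′ x ≡ ℕ→ℚ J′ * sumTo ⌊ j /2⌋ (summand J′ x)) (sym j≡2h)
                          (cheb-as-summands x even ⌊ j /2⌋ (λ 2h≡0 → ℕP.n>0⇒n≢0 j≥1 (trans j≡2h 2h≡0)))
... | inj₂ j≡2h+1 = subst (λ J′ → cheb J′ x ≡ ℕ→ℚ J′ * sumTo ⌊ j /2⌋ (summand J′ x)) (sym j≡2h+1)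
                          (cheb-as-summands x odd ⌊ j /2⌋ (λ ()))
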